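{- Let $\mu\subseteq\lambda$ be partitions and let $X_\mu^\lambda$, $\ell$, $\mathrm{wt}$ and $\Phi$ be as defined in the context. Then $\Phi$ is an involution on $X_\mu^\lambda$ (i.e. $\Phi(\Phi(T))=T$ for all $T$), it is weight-preserving ($\mathrm{wt}(\Phi(T))=\mathrm{wt}(T)$ for all $T$), and it is sign-reversing: for every $T$ with $\Phi(T)\neq T$, $(-1)^{\ell(\Phi(T))}=-(-1)^{\ell(T)}$.
   Context: Partitions are identified with their Young diagrams (English convention, cell $(i,j)$ in row $i$, column $j$). For partitions $\mu\subseteq\lambda$, let $\mathcal{C}_\mu^\lambda$ be the set of all chains $(\lambda_0,\dots,\lambda_k)$, $k\ge 0$, of partitions with $\mu=\lambda_0\subsetneq\lambda_1\subsetneq\cdots\subsetneq\lambda_k=\lambda$. Let $X_\mu^\lambda$ be the disjoint union over such chains of $\prod_{i=1}^k \mathrm{SSYT}(\lambda_i/\lambda_{i-1})$, where $\mathrm{SSYT}(\nu/\rho)$ is the set of semistandard Young tableaux (rows weakly increasing left to right, columns strictly increasing top to bottom, positive integer entries) of skew shape $\nu/\rho$. For $T=(T^{(1)},\dots,T^{(k)})\in X_\mu^\lambda$, its length is $\ell(T)=k$ and its weight is $\mathrm{wt}(T)=x^{T^{(1)}}\cdots x^{T^{(k)}}$, where $x^{U}=\prod_{c\in U}x_{U(c)}$ and $U(c)$ is the entry in cell $c$. Concatenating the $T^{(i)}$ gives a filling (also denoted $T$) of $\lambda/\mu$, not necessarily semistandard; each $T^{(i)}$ is regarded as a set of cells with entries.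 Total order on cells of $T$: for cells $c=(i,j)$, $c'=(i',j')$, $c<c'$ iff $T(c)<T(c')$, or $T(c)=T(c')$ and $j<j'$, or $T(c)=T(c')$, $j=j'$ and $i>i'$. A cell $c\in T^{(i)}$ is splittable if $|T^{(i)}|>1$ and $c$ is the largest cell of $T^{(i)}$; it is mergeable if $i>1$, $|T^{(i)}|=1$, the union $T^{(i-1)}\sqcup T^{(i)}$ is a semistandard tableau, and $c$ is larger than every cell of $T^{(i-1)}$. Let $\mathrm{cell}(T)$ be the largest cell that is splittable or mergeable, or $\emptyset$ if none exists; $T$ is called splittable (resp. mergeable) if $\mathrm{cell}(T)$ is splittable (resp. mergeable). Define $\Phi(T)$: if $T$ is splittable with $\mathrm{cell}(T)\in T^{(i)}$, $\Phi(T)=(T^{(1)},\dots,T^{(i-1)},T^{(i)}\setminus\{\mathrm{cell}(T)\},T',T^{(i+1)},\dots,T^{(k)})$ where $T'$ is the one-cell tableau consisting of $\mathrm{cell}(T)$ with its entry; if $T$ is mergeable with $\mathrm{cell}(T)\in T^{(i)}$, $\Phi(T)=(T^{(1)},\dots,T^{(i-2)},T^{(i-1)}\sqcup T^{(i)},T^{(i+1)},\dots,T^{(k)})$; if $\mathrm{cell}(T)=\emptyset$, $\Phi(T)=T$. (This map sends $X_\mu^\lambda$ into itself.) -}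

module Defs where

open import Data.Nat using (ℕ; zero; suc; _+_; _∸_; _≤_; _<_; _≡ᵇ_; _<ᵇ_; _≤ᵇ_)
open import Data.Bool using (Bool; true; false; _∧_; _∨_; not; if_then_else_)
open import Data.List using (List; []; _∷_; length; map; concatMap; upTo; zip; filterᵇ; foldr; lookup)
open import Data.List.Relation.Unary.All using (All)
open import Data.List.Relation.Unary.Any using (Any)
open import Data.List.Relation.Unary.Linked using (Linked)
open import Data.List.Membership.Propositional using (_∈_)
open import Data.Maybe using (Maybe; just; nothing)
open import Data.Product using (_×_; _,_; proj₁; proj₂; Σ; ∃)
open import Data.Sum using (_⊎_)
open import Data.Integer using (ℤ; -[1+_]) renaming (_^_ to _^ℤ_)
open import Relation.Binary.PropositionalEquality using (_≡_)

-- Cells are pairs (row , column), 0-indexed (only relative comparisons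
-- of rows/columns matter below, so the indexing offset is irrelevant).

Partition : Set
Partition = List ℕ

IsPartition : Partition → Set
IsPartition p = Linked (λ a b → b ≤ a) p × All (λ a → 1 ≤ a) p

part : Partition → ℕ → ℕ
part []       _       = 0
part (a ∷ p)  zero    = a
part (a ∷ p)  (suc i) = part p i

Cell : Set
Cell = ℕ × ℕ

row col : Cell → ℕ
row = proj₁
col = proj₂

InDiagram : Partition → Cell → Set
InDiagram p (i , j) = j < part p i

_⊆ₚ_ : Partition → Partition → Set
mu ⊆ₚ la = ∀ c → InDiagram mu c → InDiagram la c

rowCells : ℕ → ℕ → ℕ → List Cell
rowCells r a b = map (λ t → (r , a + t)) (upTo (b ∸ a))

skewCells : Partition → Partition → List Cell
skewCells la mu = concatMap (λ r → rowCells r (part mu r) (part la r)) (upTo (length la))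

-- An element T = (T^(1),…,T^(k)) is encoded canonically by its length k
-- together with, for each cell of la/mu (in the canonical order of
-- skewCells), the pair (block index b ∈ {1..k}, entry T(c) ≥ 1), meaning
-- the cell belongs to T^(b) with that entry.  The chain is recovered as
-- la_i = mu ∪ {cells with block ≤ i}.

Elt : Set
Elt = ℕ × List (ℕ × ℕ)

ℓ : Elt → ℕ
ℓ = proj₁

LCell : Set
LCell = Cell × ℕ × ℕ

lcell : LCell → Cell
lcell = proj₁
blk : LCell → ℕ
blk x = proj₁ (proj₂ x)
ent : LCell → ℕ
ent x = proj₂ (proj₂ x)

labelled : Partition → Partition → Elt → List LCell
labelled la mu T = zip (skewCells la mu) (proj₂ T)

InLevel : Partition → Partition → Elt → ℕ → Cell → Set
InLevel la mu T i c = InDiagram mu c ⊎ Any (λ x → lcell x ≡ c × blk x ≤ i) (labelled la mu T)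

IsDiagram : (Cell → Set) → Set
IsDiagram P = (∀ r j → P (r , suc j) → P (r , j)) × (∀ r j → P (suc r , j) → P (r , j))

SemistandardSet : List LCell → Set
SemistandardSet S =
  All (λ x → All (λ y →
        (row (lcell x) ≡ row (lcell y) → col (lcell x) < col (lcell y) → ent x ≤ ent y)
      × (col (lcell x) ≡ col (lcell y) → row (lcell x) < row (lcell y) → ent x < ent y)) S) S

blockOf : ℕ → List LCell → List LCell
blockOf b = filterᵇ (λ x → blk x ≡ᵇ b)

InX : Partition → Partition → Elt → Set
InX la mu T =
    length (proj₂ T) ≡ length (skewCells la mu)
  × All (λ x → (1 ≤ blk x × blk x ≤ ℓ T) × 1 ≤ ent x) (labelled la mu T)
  -- each inclusion la_{b-1} ⊊ la_b is strict
  × (∀ b → 1 ≤ b → b ≤ ℓ T → Any (λ x → blk x ≡ b) (labelled la mu T))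
  × (∀ i → i ≤ ℓ T → IsDiagram (InLevel la mu T i))
  × (∀ b → 1 ≤ b → b ≤ ℓ T → SemistandardSet (blockOf b (labelled la mu T)))

-- Weight: wt T = ∏_n x_n^(wt T n); we record the exponent of each x_n.

wt : Elt → ℕ → ℕ
wt T n = length (filterᵇ (λ be → proj₂ be ≡ᵇ n) (proj₂ T))

sgn : ℕ → ℤ
sgn k = -[1+ 0 ] ^ℤ k

sameCell : Cell → Cell → Bool
sameCell (i , j) (i' , j') = (i ≡ᵇ i') ∧ (j ≡ᵇ j')

ltᶜ : LCell → LCell → Bool
ltᶜ x y =
  (ent x <ᵇ ent y) ∨
  ((ent x ≡ᵇ ent y) ∧ ((col (lcell x) <ᵇ col (lcell y)) ∨
      ((col (lcell x) ≡ᵇ col (lcell y)) ∧ (row (lcell y) <ᵇ row (lcell x)))))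

allᵇ : {A : Set} → (A → Bool) → List A → Bool
allᵇ p [] = true
allᵇ p (x ∷ xs) = p x ∧ allᵇ p xs

ssytᵇ : List LCell → Bool
ssytᵇ S = allᵇ (λ x → allᵇ (λ y →
     (not ((row (lcell x) ≡ᵇ row (lcell y)) ∧ (col (lcell x) <ᵇ col (lcell y))) ∨ (ent x ≤ᵇ ent y))
   ∧ (not ((col (lcell x) ≡ᵇ col (lcell y)) ∧ (row (lcell x) <ᵇ row (lcell y))) ∨ (ent x <ᵇ ent y))) S) S

_++ᵇ_ : List LCell → List LCell → List LCell
[] ++ᵇ ys = ys
(x ∷ xs) ++ᵇ ys = x ∷ (xs ++ᵇ ys)

splittable : List LCell → LCell → Bool
splittable L c =
  let S = blockOf (blk c) L in
  (1 <ᵇ length S) ∧ allᵇ (λ d → sameCell (lcell d) (lcell c) ∨ ltᶜ d c) S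

mergeable : List LCell → LCell → Bool
mergeable L c =
  let S = blockOf (blk c) L
      P = blockOf (blk c ∸ 1) L in
  (1 <ᵇ blk c) ∧ (length S ≡ᵇ 1) ∧ ssytᵇ (P ++ᵇ S) ∧ allᵇ (λ d → ltᶜ d c) P

maxCell : List LCell → Maybe LCell
maxCell = foldr step nothing
  where
  step : LCell → Maybe LCell → Maybe LCell
  step x nothing  = just x
  step x (just y) = if ltᶜ y x then just x else just y

cellOf : List LCell → Maybe LCell
cellOf L = maxCell (filterᵇ (λ c → splittable L c ∨ mergeable L c) L)

relabel : (LCell → ℕ) → List LCell → List (ℕ × ℕ)
relabel f = map (λ x → (f x , ent x))

Φ : Partition → Partition → Elt → Elt
Φ la mu T with cellOf (labelled la mu T)
... | nothing = T
... | just c =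
  let L = labelled la mu T
      b = blk c in
  if splittable L c
  then (suc (ℓ T) , relabel (λ x → if sameCell (lcell x) (lcell c) then suc b
                                   else if b <ᵇ blk x then suc (blk x) else blk x) L)
  else (ℓ T ∸ 1 , relabel (λ x → if sameCell (lcell x) (lcell c) then b ∸ 1
                                 else if b <ᵇ blk x then blk x ∸ 1 else blk x) L)

{-# OPTIONS --safe #-}
-- Φ never moves an entry, it only relabels blocks. Splitting at c = cell(T), the largest cell of
-- its block b, puts c alone into a new block b + 1 and shifts the later blocks up; merging at a
-- mergeable c, alone in block b, moves it into block b − 1 and shifts the later blocks down.
-- Being the largest cell of a semistandard block, c is a corner of it, so both moves stay in X;
-- the filling and hence the weight are untouched, and the length changes by one. The point is
-- that cell(Φ T) is again c: after a split c is mergeable, after a merge it is splittable, and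
-- every other cell that is splittable or mergeable after the move either has its block and the
-- previous one relabelled together, so it was already splittable or mergeable and lies below c,
-- or sits in block b − 1, b or b + 1, where it lies below c directly. The opposite move at c then
-- restores T.
module Submission where

open import Defs
open import Data.Nat
  using (ℕ; zero; suc; _+_; _∸_; _≤_; _<_; _≡ᵇ_; _<ᵇ_; _≤ᵇ_; _≟_; z≤n; s≤s; pred; >-nonZero)
open import Data.Nat.Properties
open import Data.Bool using (Bool; true; false; _∧_; _∨_; not; if_then_else_)
import Data.Bool as Bool
open import Data.Bool.Properties using (T-≡; ¬-not; not-¬; ∧-conicalˡ; ∧-conicalʳ; ∨-zeroʳ)
open import Data.List using (List; []; _∷_; length; map; filterᵇ; _++_; zip; concatMap; upTo)
open import Data.List.Properties using (filter-none; length-map; map-++; map-∘; map-cong-local)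
open import Data.List.Relation.Unary.All as All using (All; []; _∷_)
import Data.List.Relation.Unary.All.Properties as All
open import Data.List.Relation.Unary.Any using (Any; here; there)
import Data.List.Relation.Unary.Any.Properties as Any
open import Data.List.Relation.Unary.AllPairs using (_∷_)
open import Data.List.Relation.Unary.Unique.Propositional using (Unique; [])
import Data.List.Relation.Unary.Unique.Propositional.Properties as Unique
open import Data.List.Membership.Propositional using (_∈_; find; lose)
open import Data.List.Membership.Propositional.Properties
  using (∈-filter⁻; ∈-filter⁺; ∈-++⁻; ∈-++⁺ˡ; ∈-++⁺ʳ; ∈-map⁺; ∈-map⁻; ∈-concat⁻′)
open import Data.Maybe using (just; nothing)
open import Data.Product using (_×_; _,_; proj₁; proj₂; ∃; map₂)
open import Data.Product.Properties using (≡-dec)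
open import Data.Sum using (_⊎_; inj₁; inj₂; [_,_]′)
open import Data.Empty using (⊥; ⊥-elim)
open import Data.Integer using (-_)
open import Data.Integer.Properties using (-1*i≡-i; neg-involutive)
open import Function using (id; _∘_; _⇔_; mk⇔; Equivalence)
open import Relation.Nullary using (¬_; Dec; yes; no)
open import Relation.Nullary.Decidable using (T?)
open import Relation.Binary using (tri<; tri≈; tri>)
open import Relation.Binary.PropositionalEquality

≢true⇒≡false : ∀ {b} → b ≢ true → b ≡ false
≢true⇒≡false = ¬-not

≡true⇒≢false : ∀ {b} → b ≡ true → b ≢ false
≡true⇒≢false = not-¬

T⇒≡true : ∀ {b} → Bool.T b → b ≡ true
T⇒≡true = Equivalence.to T-≡

≡true⇒T : ∀ {b} → b ≡ true → Bool.T b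
≡true⇒T = Equivalence.from T-≡

≡true-ext : ∀ {a b} → (a ≡ true ⇔ b ≡ true) → a ≡ b
≡true-ext {true} a⇔b = sym (Equivalence.to a⇔b refl)
≡true-ext {false} {false} _ = refl
≡true-ext {false} {true} a⇔b = Equivalence.from a⇔b refl

∧≡true⁻ : ∀ a {b} → a ∧ b ≡ true → a ≡ true × b ≡ true
∧≡true⁻ a {b} a∧b = ∧-conicalˡ a b a∧b , ∧-conicalʳ a b a∧b

∧≡true⁺ : ∀ {a b} → a ≡ true → b ≡ true → a ∧ b ≡ true
∧≡true⁺ refl b≡true = b≡true

∨≡true⁻ : ∀ a {b} → a ∨ b ≡ true → a ≡ true ⊎ b ≡ true
∨≡true⁻ true _ = inj₁ refl
∨≡true⁻ false b≡true = inj₂ b≡true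

∨≡trueˡ : ∀ {a} b → a ≡ true → a ∨ b ≡ true
∨≡trueˡ _ refl = refl

∨≡trueʳ : ∀ a {b} → b ≡ true → a ∨ b ≡ true
∨≡trueʳ a refl = ∨-zeroʳ a

implication⁺ : ∀ a b c → (a ≡ true → b ≡ true → c ≡ true) → not (a ∧ b) ∨ c ≡ true
implication⁺ true true _ a∧b⇒c = a∧b⇒c refl refl
implication⁺ true false _ _ = refl
implication⁺ false _ _ _ = refl

implication⁻ : ∀ a b c → not (a ∧ b) ∨ c ≡ true → a ≡ true → b ≡ true → c ≡ true
implication⁻ true true _ c≡true refl refl = c≡true

if-true : ∀ {A : Set} {b} {x y : A} → b ≡ true → (if b then x else y) ≡ x
if-true refl = refl

if-false : ∀ {A : Set} {b} {x y : A} → b ≡ false → (if b then x else y) ≡ y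
if-false refl = refl

<⇒<ᵇ≡true : ∀ {m n} → m < n → (m <ᵇ n) ≡ true
<⇒<ᵇ≡true = T⇒≡true ∘ <⇒<ᵇ

<ᵇ≡true⇒< : ∀ m n → (m <ᵇ n) ≡ true → m < n
<ᵇ≡true⇒< m n = <ᵇ⇒< m n ∘ ≡true⇒T

≥⇒<ᵇ≡false : ∀ {m n} → n ≤ m → (m <ᵇ n) ≡ false
≥⇒<ᵇ≡false {m} {n} n≤m = ≢true⇒≡false (λ e → <⇒≱ (<ᵇ≡true⇒< m n e) n≤m)

≡⇒≡ᵇ≡true : ∀ {m n} → m ≡ n → (m ≡ᵇ n) ≡ true
≡⇒≡ᵇ≡true {m} {n} = T⇒≡true ∘ ≡⇒≡ᵇ m n

≡ᵇ≡true⇒≡ : ∀ m n → (m ≡ᵇ n) ≡ true → m ≡ n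
≡ᵇ≡true⇒≡ m n = ≡ᵇ⇒≡ m n ∘ ≡true⇒T

≤⇒≤ᵇ≡true : ∀ {m n} → m ≤ n → (m ≤ᵇ n) ≡ true
≤⇒≤ᵇ≡true = T⇒≡true ∘ ≤⇒≤ᵇ

≤ᵇ≡true⇒≤ : ∀ m n → (m ≤ᵇ n) ≡ true → m ≤ n
≤ᵇ≡true⇒≤ m n = ≤ᵇ⇒≤ m n ∘ ≡true⇒T

≡ᵇ-cong : ∀ {m n m′ n′} → (m ≡ n ⇔ m′ ≡ n′) → (m ≡ᵇ n) ≡ (m′ ≡ᵇ n′)
≡ᵇ-cong {m} {n} {m′} {n′} eq = ≡true-ext (mk⇔
  (≡⇒≡ᵇ≡true ∘ Equivalence.to eq ∘ ≡ᵇ≡true⇒≡ m n)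
  (≡⇒≡ᵇ≡true ∘ Equivalence.from eq ∘ ≡ᵇ≡true⇒≡ m′ n′))

<ᵇ-cong : ∀ {m n m′ n′} → (m < n ⇔ m′ < n′) → (m <ᵇ n) ≡ (m′ <ᵇ n′)
<ᵇ-cong {m} {n} {m′} {n′} lt = ≡true-ext (mk⇔
  (<⇒<ᵇ≡true ∘ Equivalence.to lt ∘ <ᵇ≡true⇒< m n)
  (<⇒<ᵇ≡true ∘ Equivalence.from lt ∘ <ᵇ≡true⇒< m′ n′))

_≺ᵖ_ : Cell → Cell → Set
p ≺ᵖ q = col p < col q ⊎ (col p ≡ col q × row q < row p)

_≺_ : LCell → LCell → Set
x ≺ y = ent x < ent y ⊎ (ent x ≡ ent y × lcell x ≺ᵖ lcell y)

_≈ᶜ_ : LCell → LCell → Set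
x ≈ᶜ y = lcell x ≡ lcell y × ent x ≡ ent y

ltᶜ⇒≺ : ∀ x y → ltᶜ x y ≡ true → x ≺ y
ltᶜ⇒≺ x y lt with ∨≡true⁻ (ent x <ᵇ ent y) lt
... | inj₁ e< = inj₁ (<ᵇ≡true⇒< _ _ e<)
... | inj₂ rest with ∧≡true⁻ (ent x ≡ᵇ ent y) rest
... | e≡ , rest′ with ∨≡true⁻ (col (lcell x) <ᵇ col (lcell y)) rest′
... | inj₁ c< = inj₂ (≡ᵇ≡true⇒≡ _ _ e≡ , inj₁ (<ᵇ≡true⇒< _ _ c<))
... | inj₂ rest″ with ∧≡true⁻ (col (lcell x) ≡ᵇ col (lcell y)) rest″
... | c≡ , r> = inj₂ (≡ᵇ≡true⇒≡ _ _ e≡ , inj₂ (≡ᵇ≡true⇒≡ _ _ c≡ , <ᵇ≡true⇒< _ _ r>))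

≺⇒ltᶜ : ∀ x y → x ≺ y → ltᶜ x y ≡ true
≺⇒ltᶜ x y (inj₁ e<) = ∨≡trueˡ _ (<⇒<ᵇ≡true e<)
≺⇒ltᶜ x y (inj₂ (e≡ , inj₁ c<)) =
  ∨≡trueʳ (ent x <ᵇ ent y) (∧≡true⁺ (≡⇒≡ᵇ≡true e≡) (∨≡trueˡ _ (<⇒<ᵇ≡true c<)))
≺⇒ltᶜ x y (inj₂ (e≡ , inj₂ (c≡ , r>))) =
  ∨≡trueʳ (ent x <ᵇ ent y) (∧≡true⁺ (≡⇒≡ᵇ≡true e≡)
    (∨≡trueʳ (col (lcell x) <ᵇ col (lcell y)) (∧≡true⁺ (≡⇒≡ᵇ≡true c≡) (<⇒<ᵇ≡true r>))))

≺-irrefl : ∀ x → ¬ x ≺ x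
≺-irrefl x (inj₁ e<) = <-irrefl refl e<
≺-irrefl x (inj₂ (_ , inj₁ c<)) = <-irrefl refl c<
≺-irrefl x (inj₂ (_ , inj₂ (_ , r>))) = <-irrefl refl r>

≺ᵖ-trans : ∀ p q r → p ≺ᵖ q → q ≺ᵖ r → p ≺ᵖ r
≺ᵖ-trans p q r (inj₁ a) (inj₁ b) = inj₁ (<-trans a b)
≺ᵖ-trans p q r (inj₁ a) (inj₂ (c , _)) = inj₁ (subst (col p <_) c a)
≺ᵖ-trans p q r (inj₂ (c , _)) (inj₁ b) = inj₁ (subst (_< col r) (sym c) b)
≺ᵖ-trans p q r (inj₂ (c , a)) (inj₂ (c′ , b)) = inj₂ (trans c c′ , <-trans b a)

≺-trans : ∀ x y z → x ≺ y → y ≺ z → x ≺ z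
≺-trans x y z (inj₁ a) (inj₁ b) = inj₁ (<-trans a b)
≺-trans x y z (inj₁ a) (inj₂ (e , _)) = inj₁ (subst (ent x <_) e a)
≺-trans x y z (inj₂ (e , _)) (inj₁ b) = inj₁ (subst (_< ent z) (sym e) b)
≺-trans x y z (inj₂ (e , p)) (inj₂ (e′ , q)) = inj₂ (trans e e′ , ≺ᵖ-trans (lcell x) (lcell y) (lcell z) p q)

≺-trichotomous : ∀ x y → ¬ x ≺ y → ¬ y ≺ x → x ≈ᶜ y
≺-trichotomous x y x⊀y y⊀x with <-cmp (ent x) (ent y)
... | tri< a _ _ = ⊥-elim (x⊀y (inj₁ a))
... | tri> _ _ a = ⊥-elim (y⊀x (inj₁ a))
... | tri≈ _ e _ with <-cmp (col (lcell x)) (col (lcell y))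
... | tri< a _ _ = ⊥-elim (x⊀y (inj₂ (e , inj₁ a)))
... | tri> _ _ a = ⊥-elim (y⊀x (inj₂ (sym e , inj₁ a)))
... | tri≈ _ c _ with <-cmp (row (lcell x)) (row (lcell y))
... | tri< a _ _ = ⊥-elim (y⊀x (inj₂ (sym e , inj₂ (sym c , a))))
... | tri> _ _ a = ⊥-elim (x⊀y (inj₂ (e , inj₂ (c , a))))
... | tri≈ _ r _ = cong₂ _,_ r c , e

ltᶜ-trans : ∀ x y z → ltᶜ x y ≡ true → ltᶜ y z ≡ true → ltᶜ x z ≡ true
ltᶜ-trans x y z x<y y<z = ≺⇒ltᶜ x z (≺-trans x y z (ltᶜ⇒≺ x y x<y) (ltᶜ⇒≺ y z y<z))

ltᶜ-asym : ∀ x y → ltᶜ x y ≡ true → ltᶜ y x ≡ false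
ltᶜ-asym x y x<y = ≢true⇒≡false λ y<x →
  ≺-irrefl x (≺-trans x y x (ltᶜ⇒≺ x y x<y) (ltᶜ⇒≺ y x y<x))

ltᶜ-trichotomous : ∀ x y → ltᶜ x y ≡ false → ltᶜ y x ≡ false → x ≈ᶜ y
ltᶜ-trichotomous x y x≮y y≮x = ≺-trichotomous x y
  (λ x≺y → ≡true⇒≢false (≺⇒ltᶜ x y x≺y) x≮y)
  (λ y≺x → ≡true⇒≢false (≺⇒ltᶜ y x y≺x) y≮x)

ltᶜ-respˡ-≈ᶜ : ∀ x y z → x ≈ᶜ y → ltᶜ x z ≡ ltᶜ y z
ltᶜ-respˡ-≈ᶜ (_ , _ , _) (_ , _ , _) z (refl , refl) = refl

_≟ᶜ_ : (p q : Cell) → Dec (p ≡ q)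
_≟ᶜ_ = ≡-dec _≟_ _≟_

≡⇒sameCell≡true : ∀ p q → p ≡ q → sameCell p q ≡ true
≡⇒sameCell≡true (i , j) _ refl = ∧≡true⁺ (≡⇒≡ᵇ≡true {i} refl) (≡⇒≡ᵇ≡true {j} refl)

sameCell≡true⇒≡ : ∀ p q → sameCell p q ≡ true → p ≡ q
sameCell≡true⇒≡ (i , j) (i′ , j′) same with ∧≡true⁻ (i ≡ᵇ i′) same
... | i≡i′ , j≡j′ = cong₂ _,_ (≡ᵇ≡true⇒≡ _ _ i≡i′) (≡ᵇ≡true⇒≡ _ _ j≡j′)

≢⇒sameCell≡false : ∀ p q → p ≢ q → sameCell p q ≡ false
≢⇒sameCell≡false p q p≢q = ≢true⇒≡false (p≢q ∘ sameCell≡true⇒≡ p q)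

module _ {A : Set} where

  ∈-filterᵇ⁻ : ∀ (p : A → Bool) {xs x} → x ∈ filterᵇ p xs → x ∈ xs × p x ≡ true
  ∈-filterᵇ⁻ p = map₂ T⇒≡true ∘ ∈-filter⁻ (T? ∘ p)

  ∈-filterᵇ⁺ : ∀ (p : A → Bool) {xs x} → x ∈ xs → p x ≡ true → x ∈ filterᵇ p xs
  ∈-filterᵇ⁺ p x∈xs px = ∈-filter⁺ (T? ∘ p) x∈xs (≡true⇒T px)

  filterᵇ-cong-∈ : ∀ (p q : A → Bool) xs → (∀ {x} → x ∈ xs → p x ≡ q x) →
                   filterᵇ p xs ≡ filterᵇ q xs
  filterᵇ-cong-∈ p q [] _ = refl
  filterᵇ-cong-∈ p q (y ∷ xs) p≗q with p y in py | q y in qy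
  ... | true | true = cong (y ∷_) (filterᵇ-cong-∈ p q xs (p≗q ∘ there))
  ... | false | false = filterᵇ-cong-∈ p q xs (p≗q ∘ there)
  ... | true | false = ⊥-elim (≡true⇒≢false (trans (sym (p≗q (here refl))) py) qy)
  ... | false | true = ⊥-elim (≡true⇒≢false (trans (p≗q (here refl)) qy) py)

  allᵇ⁺ : ∀ (p : A → Bool) xs → (∀ {x} → x ∈ xs → p x ≡ true) → allᵇ p xs ≡ true
  allᵇ⁺ p [] _ = refl
  allᵇ⁺ p (x ∷ xs) all-p = ∧≡true⁺ (all-p (here refl)) (allᵇ⁺ p xs (all-p ∘ there))

  allᵇ⁻ : ∀ (p : A → Bool) xs → allᵇ p xs ≡ true → ∀ {x} → x ∈ xs → p x ≡ true
  allᵇ⁻ p (y ∷ xs) all-p (here refl) = proj₁ (∧≡true⁻ (p y) all-p)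
  allᵇ⁻ p (y ∷ xs) all-p (there x∈xs) = allᵇ⁻ p xs (proj₂ (∧≡true⁻ (p y) all-p)) x∈xs

  allᵇ-cong : ∀ (p q : A → Bool) xs → (∀ x → p x ≡ q x) → allᵇ p xs ≡ allᵇ q xs
  allᵇ-cong p q [] _ = refl
  allᵇ-cong p q (x ∷ xs) p≗q = cong₂ _∧_ (p≗q x) (allᵇ-cong p q xs p≗q)

  length≡1⇒≡ : ∀ (xs : List A) {x y} → length xs ≡ 1 → x ∈ xs → y ∈ xs → x ≡ y
  length≡1⇒≡ (_ ∷ []) _ (here refl) (here refl) = refl

  ≢⇒1<length : ∀ (xs : List A) {x y} → x ∈ xs → y ∈ xs → x ≢ y → 1 < length xs
  ≢⇒1<length (_ ∷ []) (here refl) (here refl) x≢y = ⊥-elim (x≢y refl)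
  ≢⇒1<length (_ ∷ _ ∷ _) _ _ _ = s≤s (s≤s z≤n)

  filterᵇ-nonempty : ∀ (p : A → Bool) xs → 0 < length (filterᵇ p xs) → ∃ λ x → x ∈ xs × p x ≡ true
  filterᵇ-nonempty p (y ∷ xs) nonempty with p y in py
  ... | true = y , here refl , py
  ... | false with filterᵇ-nonempty p xs nonempty
  ... | x , x∈xs , px = x , there x∈xs , px

module _ {A B : Set} where

  filterᵇ-map : ∀ (p : B → Bool) (g : A → B) xs → filterᵇ p (map g xs) ≡ map g (filterᵇ (p ∘ g) xs)
  filterᵇ-map p g [] = refl
  filterᵇ-map p g (x ∷ xs) with p (g x)
  ... | true = cong (g x ∷_) (filterᵇ-map p g xs)
  ... | false = filterᵇ-map p g xs

  allᵇ-map : ∀ (p : B → Bool) (g : A → B) xs → allᵇ p (map g xs) ≡ allᵇ (p ∘ g) xs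
  allᵇ-map p g [] = refl
  allᵇ-map p g (x ∷ xs) = cong (p (g x) ∧_) (allᵇ-map p g xs)

++ᵇ≡++ : ∀ xs ys → xs ++ᵇ ys ≡ xs ++ ys
++ᵇ≡++ [] ys = refl
++ᵇ≡++ (x ∷ xs) ys = cong (x ∷_) (++ᵇ≡++ xs ys)

Compatible : LCell → LCell → Set
Compatible x y =
    (row (lcell x) ≡ row (lcell y) → col (lcell x) < col (lcell y) → ent x ≤ ent y)
  × (col (lcell x) ≡ col (lcell y) → row (lcell x) < row (lcell y) → ent x < ent y)

compatibleᵇ : LCell → LCell → Bool
compatibleᵇ x y =
    (not ((row (lcell x) ≡ᵇ row (lcell y)) ∧ (col (lcell x) <ᵇ col (lcell y))) ∨ (ent x ≤ᵇ ent y))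
  ∧ (not ((col (lcell x) ≡ᵇ col (lcell y)) ∧ (row (lcell x) <ᵇ row (lcell y))) ∨ (ent x <ᵇ ent y))

Compatible⇒compatibleᵇ : ∀ x y → Compatible x y → compatibleᵇ x y ≡ true
Compatible⇒compatibleᵇ x y (inRow , inCol) = ∧≡true⁺
  (implication⁺ _ _ _ (λ r c → ≤⇒≤ᵇ≡true (inRow (≡ᵇ≡true⇒≡ _ _ r) (<ᵇ≡true⇒< _ _ c))))
  (implication⁺ _ _ _ (λ c r → <⇒<ᵇ≡true (inCol (≡ᵇ≡true⇒≡ _ _ c) (<ᵇ≡true⇒< _ _ r))))

compatibleᵇ⇒Compatible : ∀ x y → compatibleᵇ x y ≡ true → Compatible x y
compatibleᵇ⇒Compatible x y compat
  with ∧≡true⁻ (not ((row (lcell x) ≡ᵇ row (lcell y)) ∧ (col (lcell x) <ᵇ col (lcell y)))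
                ∨ (ent x ≤ᵇ ent y)) compat
... | inRow , inCol =
  (λ r c → ≤ᵇ≡true⇒≤ _ _ (implication⁻ _ _ _ inRow (≡⇒≡ᵇ≡true r) (<⇒<ᵇ≡true c))) ,
  (λ c r → <ᵇ≡true⇒< _ _ (implication⁻ _ _ _ inCol (≡⇒≡ᵇ≡true c) (<⇒<ᵇ≡true r)))

ssytᵇ⁺ : ∀ S → (∀ {x y} → x ∈ S → y ∈ S → Compatible x y) → ssytᵇ S ≡ true
ssytᵇ⁺ S compat = allᵇ⁺ _ S λ {x} x∈S → allᵇ⁺ _ S λ {y} y∈S →
  Compatible⇒compatibleᵇ x y (compat x∈S y∈S)

ssytᵇ⁻ : ∀ S → ssytᵇ S ≡ true → ∀ {x y} → x ∈ S → y ∈ S → Compatible x y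
ssytᵇ⁻ S ssyt {x} {y} x∈S y∈S = compatibleᵇ⇒Compatible x y (allᵇ⁻ _ S (allᵇ⁻ _ S ssyt x∈S) y∈S)

SemistandardSet⁺ : ∀ {S} → (∀ {x y} → x ∈ S → y ∈ S → Compatible x y) → SemistandardSet S
SemistandardSet⁺ compat = All.tabulate λ x∈S → All.tabulate λ y∈S → compat x∈S y∈S

SemistandardSet⁻ : ∀ {S} → SemistandardSet S → ∀ {x y} → x ∈ S → y ∈ S → Compatible x y
SemistandardSet⁻ ss x∈S y∈S = All.lookup (All.lookup ss x∈S) y∈S

≺⇒ent≤ : ∀ x y → x ≺ y → ent x ≤ ent y
≺⇒ent≤ x y (inj₁ e<) = <⇒≤ e<
≺⇒ent≤ x y (inj₂ (e≡ , _)) = ≤-reflexive e≡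

≺⇒Compatible : ∀ x y → x ≺ y → Compatible x y
≺⇒Compatible x y x≺y = (λ _ _ → ≺⇒ent≤ x y x≺y) , inCol x≺y
  where
  inCol : x ≺ y → col (lcell x) ≡ col (lcell y) → row (lcell x) < row (lcell y) → ent x < ent y
  inCol (inj₁ e<) _ _ = e<
  inCol (inj₂ (_ , inj₁ c<)) c≡ _ = ⊥-elim (<-irrefl c≡ c<)
  inCol (inj₂ (_ , inj₂ (_ , r>))) _ r< = ⊥-elim (<-asym r> r<)

-- The largest candidate cell

IsGreatest : List LCell → LCell → Set
IsGreatest xs m = ∀ {y} → y ∈ xs → y ≈ᶜ m ⊎ ltᶜ y m ≡ true

maxCell-∈ : ∀ xs {m} → maxCell xs ≡ just m → m ∈ xs
maxCell-∈ (x ∷ xs) max≡m with maxCell xs in max-xs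
maxCell-∈ (x ∷ xs) refl | nothing = here refl
maxCell-∈ (x ∷ xs) max≡m | just y with ltᶜ y x
maxCell-∈ (x ∷ xs) refl | just y | true = here refl
maxCell-∈ (x ∷ xs) refl | just y | false = there (maxCell-∈ xs max-xs)

maxCell≡nothing⇒≡[] : ∀ xs → maxCell xs ≡ nothing → xs ≡ []
maxCell≡nothing⇒≡[] [] _ = refl
maxCell≡nothing⇒≡[] (x ∷ xs) max≡nothing with maxCell xs
maxCell≡nothing⇒≡[] (x ∷ xs) () | nothing
maxCell≡nothing⇒≡[] (x ∷ xs) max≡nothing | just y with ltᶜ y x
maxCell≡nothing⇒≡[] (x ∷ xs) () | just y | true
maxCell≡nothing⇒≡[] (x ∷ xs) () | just y | false

maxCell-greatest : ∀ xs {m} → maxCell xs ≡ just m → IsGreatest xs m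
maxCell-greatest (x ∷ xs) max≡m z∈ with maxCell xs in max-xs
maxCell-greatest (x ∷ xs) refl (here refl) | nothing = inj₁ (refl , refl)
maxCell-greatest (x ∷ xs) refl (there z∈xs) | nothing with maxCell≡nothing⇒≡[] xs max-xs
maxCell-greatest (x ∷ xs) refl (there ()) | nothing | refl
maxCell-greatest (x ∷ xs) max≡m z∈ | just y with ltᶜ y x in y<x
maxCell-greatest (x ∷ xs) refl (here refl) | just y | true = inj₁ (refl , refl)
maxCell-greatest (x ∷ xs) (refl) {z} (there z∈xs) | just y | true
  with maxCell-greatest xs max-xs z∈xs
... | inj₁ z≈y = inj₂ (trans (ltᶜ-respˡ-≈ᶜ z y x z≈y) y<x)
... | inj₂ z<y = inj₂ (ltᶜ-trans z y x z<y y<x)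
maxCell-greatest (x ∷ xs) refl (here refl) | just y | false with ltᶜ x y in x<y
... | true = inj₂ refl
... | false = inj₁ (ltᶜ-trichotomous x y x<y y<x)
maxCell-greatest (x ∷ xs) refl (there z∈xs) | just y | false = maxCell-greatest xs max-xs z∈xs

greatest⇒maxCell : ∀ xs m → m ∈ xs → (∀ {x} → x ∈ xs → lcell x ≡ lcell m → x ≡ m) →
                   IsGreatest xs m → maxCell xs ≡ just m
greatest⇒maxCell (x ∷ xs) m m∈ unique greatest with lcell x ≟ᶜ lcell m
greatest⇒maxCell (x ∷ xs) m m∈ unique greatest | yes same with unique (here refl) same
greatest⇒maxCell (.m ∷ xs) m m∈ unique greatest | yes same | refl with maxCell xs in max-xs
... | nothing = refl
... | just y with greatest (there (maxCell-∈ xs max-xs))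
... | inj₁ (y≡m , _) with unique (there (maxCell-∈ xs max-xs)) y≡m
... | refl with ltᶜ m m
... | true = refl
... | false = refl
greatest⇒maxCell (.m ∷ xs) m m∈ unique greatest | yes same | refl | just y | inj₂ y<m
  rewrite y<m = refl
greatest⇒maxCell (x ∷ xs) m (here refl) unique greatest | no differ = ⊥-elim (differ refl)
greatest⇒maxCell (x ∷ xs) m (there m∈xs) unique greatest | no differ
  rewrite greatest⇒maxCell xs m m∈xs (unique ∘ there) (greatest ∘ there) with greatest (here refl)
... | inj₁ (same , _) = ⊥-elim (differ same)
... | inj₂ x<m rewrite ltᶜ-asym x m x<m = refl

DistinctCells : List LCell → Set
DistinctCells L = Unique (map lcell L)

lcell-injective : ∀ {L} → DistinctCells L → ∀ {x y} → x ∈ L → y ∈ L → lcell x ≡ lcell y → x ≡ y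
lcell-injective _ (here refl) (here refl) _ = refl
lcell-injective (x∉ ∷ _) (here refl) (there y∈L) same = ⊥-elim (All.lookup (All.map⁻ x∉) y∈L same)
lcell-injective (y∉ ∷ _) (there x∈L) (here refl) same = ⊥-elim (All.lookup (All.map⁻ y∉) x∈L (sym same))
lcell-injective (_ ∷ distinct) (there x∈L) (there y∈L) same = lcell-injective distinct x∈L y∈L same

length-filterᵇ≡1 : ∀ (q : LCell → Bool) {L} → DistinctCells L → ∀ {c} → c ∈ L →
                   (∀ {x} → x ∈ L → q x ≡ true → lcell x ≡ lcell c) → q c ≡ true →
                   length (filterᵇ q L) ≡ 1
length-filterᵇ≡1 q {z ∷ L} (z∉ ∷ _) (here refl) only-c qc rewrite qc =
  cong (suc ∘ length) (filter-none (T? ∘ q) (All.tabulate λ {x} x∈L qx →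
    All.lookup (All.map⁻ z∉) x∈L (sym (only-c (there x∈L) (T⇒≡true qx)))))
length-filterᵇ≡1 q {z ∷ L} (z∉ ∷ distinct) {c} (there c∈L) only-c qc with q z in qz
... | true = ⊥-elim (All.lookup (All.map⁻ z∉) c∈L (only-c (here refl) qz))
... | false = length-filterᵇ≡1 q distinct c∈L (only-c ∘ there) qc

∃-other-∈-filterᵇ : ∀ (q : LCell → Bool) {L} → DistinctCells L → 1 < length (filterᵇ q L) →
                    ∀ c → ∃ λ x → x ∈ L × q x ≡ true × lcell x ≢ c
∃-other-∈-filterᵇ q {z ∷ L} (z∉ ∷ distinct) two c with q z in qz
... | false with ∃-other-∈-filterᵇ q distinct two c
... | x , x∈L , qx , x≢c = x , there x∈L , qx , x≢c
∃-other-∈-filterᵇ q {z ∷ L} (z∉ ∷ distinct) (s≤s nonempty) c | true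
  with filterᵇ-nonempty q L nonempty | lcell z ≟ᶜ c
... | _ | no z≢c = z , here refl , qz , z≢c
... | w , w∈L , qw | yes z≡c =
  w , there w∈L , qw , λ w≡c → All.lookup (All.map⁻ z∉) w∈L (trans z≡c (sym w≡c))

-- InLevel and the conditions of InX, for an arbitrary list of labelled cells: relabelled lists
-- are handled before they are encoded as elements again.
Level : Partition → List LCell → ℕ → Cell → Set
Level mu M i p = InDiagram mu p ⊎ Any (λ x → lcell x ≡ p × blk x ≤ i) M

ValidFilling : Partition → ℕ → List LCell → Set
ValidFilling mu k M =
    All (λ x → (1 ≤ blk x × blk x ≤ k) × 1 ≤ ent x) M
  × (∀ b → 1 ≤ b → b ≤ k → Any (λ x → blk x ≡ b) M)
  × (∀ i → i ≤ k → IsDiagram (Level mu M i))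
  × (∀ b → 1 ≤ b → b ≤ k → SemistandardSet (blockOf b M))

module _ (mu : Partition) {M : List LCell} {i : ℕ} {p : Cell} where

  Level⁻ : Level mu M i p → InDiagram mu p ⊎ ∃ λ x → x ∈ M × lcell x ≡ p × blk x ≤ i
  Level⁻ (inj₁ inMu) = inj₁ inMu
  Level⁻ (inj₂ some) = inj₂ (find some)

  Level⁺ : InDiagram mu p ⊎ (∃ λ x → x ∈ M × lcell x ≡ p × blk x ≤ i) → Level mu M i p
  Level⁺ (inj₁ inMu) = inj₁ inMu
  Level⁺ (inj₂ (_ , x∈M , at-p)) = inj₂ (lose x∈M at-p)

module _ {P : Cell → Set} (diagram : IsDiagram P) where

  IsDiagram-leftClosed : ∀ {r j j′} → j′ ≤ j → P (r , j) → P (r , j′)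
  IsDiagram-leftClosed {j = zero} z≤n p = p
  IsDiagram-leftClosed {r} {suc j} j′≤1+j p with m≤n⇒m<n∨m≡n j′≤1+j
  ... | inj₁ (s≤s j′≤j) = IsDiagram-leftClosed j′≤j (proj₁ diagram r j p)
  ... | inj₂ refl = p

  IsDiagram-upClosed : ∀ {r r′ j} → r′ ≤ r → P (r , j) → P (r′ , j)
  IsDiagram-upClosed {zero} z≤n p = p
  IsDiagram-upClosed {suc r} {j = j} r′≤1+r p with m≤n⇒m<n∨m≡n r′≤1+r
  ... | inj₁ (s≤s r′≤r) = IsDiagram-upClosed r′≤r (proj₂ diagram r j p)
  ... | inj₂ refl = p

IsDiagram-cong : ∀ {P Q : Cell → Set} → (∀ {p} → P p → Q p) → (∀ {p} → Q p → P p) →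
                 IsDiagram Q → IsDiagram P
IsDiagram-cong P⇒Q Q⇒P (left , up) = (λ r j → Q⇒P ∘ left r j ∘ P⇒Q) , (λ r j → Q⇒P ∘ up r j ∘ P⇒Q)

∈-blockOf⁺ : ∀ {L x b} → x ∈ L → blk x ≡ b → x ∈ blockOf b L
∈-blockOf⁺ {x = x} x∈L refl = ∈-filterᵇ⁺ _ x∈L (≡⇒≡ᵇ≡true {blk x} refl)

∈-blockOf⁻ : ∀ L {x b} → x ∈ blockOf b L → x ∈ L × blk x ≡ b
∈-blockOf⁻ L {x} {b} x∈B with ∈-filterᵇ⁻ _ x∈B
... | x∈L , in-b = x∈L , ≡ᵇ≡true⇒≡ (blk x) b in-b

candidate : List LCell → LCell → Bool
candidate L c = splittable L c ∨ mergeable L c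

splittable⁻ : ∀ L y → splittable L y ≡ true →
  1 < length (blockOf (blk y) L) × (∀ {d} → d ∈ blockOf (blk y) L → lcell d ≢ lcell y → ltᶜ d y ≡ true)
splittable⁻ L y split with ∧≡true⁻ (1 <ᵇ length (blockOf (blk y) L)) split
... | two , largest = <ᵇ≡true⇒< 1 _ two , λ {d} d∈ d≢y → below d∈ d≢y
  where
  below : ∀ {d} → d ∈ blockOf (blk y) L → lcell d ≢ lcell y → ltᶜ d y ≡ true
  below {d} d∈ d≢y with ∨≡true⁻ (sameCell (lcell d) (lcell y)) (allᵇ⁻ _ _ largest d∈)
  ... | inj₁ same = ⊥-elim (d≢y (sameCell≡true⇒≡ _ _ same))
  ... | inj₂ d<y = d<y

splittable⁺ : ∀ L y → 1 < length (blockOf (blk y) L) →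
              (∀ {d} → d ∈ blockOf (blk y) L → lcell d ≢ lcell y → ltᶜ d y ≡ true) → splittable L y ≡ true
splittable⁺ L y two largest =
  ∧≡true⁺ (<⇒<ᵇ≡true two) (allᵇ⁺ _ _ λ {d} d∈ → largest′ d∈ (lcell d ≟ᶜ lcell y))
  where
  largest′ : ∀ {d} → d ∈ blockOf (blk y) L → Dec (lcell d ≡ lcell y) →
             sameCell (lcell d) (lcell y) ∨ ltᶜ d y ≡ true
  largest′ {d} _ (yes same) = ∨≡trueˡ _ (≡⇒sameCell≡true _ _ same)
  largest′ {d} d∈ (no differ) = ∨≡trueʳ (sameCell (lcell d) (lcell y)) (largest d∈ differ)

mergeable⁻ : ∀ L y → mergeable L y ≡ true →
    1 < blk y × length (blockOf (blk y) L) ≡ 1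
  × ssytᵇ (blockOf (blk y ∸ 1) L ++ᵇ blockOf (blk y) L) ≡ true
  × (∀ {d} → d ∈ blockOf (blk y ∸ 1) L → ltᶜ d y ≡ true)
mergeable⁻ L y merge with ∧≡true⁻ (1 <ᵇ blk y) merge
... | late , merge₁ with ∧≡true⁻ (length (blockOf (blk y) L) ≡ᵇ 1) merge₁
... | single , merge₂ with ∧≡true⁻ (ssytᵇ (blockOf (blk y ∸ 1) L ++ᵇ blockOf (blk y) L)) merge₂
... | ssyt , largest = <ᵇ≡true⇒< 1 (blk y) late , ≡ᵇ≡true⇒≡ _ 1 single , ssyt , allᵇ⁻ _ _ largest

cellOf⁻ : ∀ L c → cellOf L ≡ just c →
  c ∈ L × candidate L c ≡ true × (∀ {y} → y ∈ L → candidate L y ≡ true → y ≈ᶜ c ⊎ ltᶜ y c ≡ true)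
cellOf⁻ L c cell≡c with ∈-filterᵇ⁻ (candidate L) (maxCell-∈ _ cell≡c)
... | c∈L , cand = c∈L , cand , λ y∈L cand-y →
  maxCell-greatest _ cell≡c (∈-filterᵇ⁺ (candidate L) y∈L cand-y)

cellOf-greatest : ∀ L {c} → cellOf L ≡ just c →
                  ∀ {y} → y ∈ L → lcell y ≢ lcell c → candidate L y ≡ true → ltᶜ y c ≡ true
cellOf-greatest L {c} cell≡c y∈L y≢c cand with proj₂ (proj₂ (cellOf⁻ L c cell≡c)) y∈L cand
... | inj₁ (same , _) = ⊥-elim (y≢c same)
... | inj₂ y<c = y<c

cellOf-mergeable : ∀ L {c} → cellOf L ≡ just c → splittable L c ≡ false → mergeable L c ≡ true
cellOf-mergeable L {c} cell≡c not-split with ∨≡true⁻ (splittable L c) (proj₁ (proj₂ (cellOf⁻ L c cell≡c)))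
... | inj₁ split = ⊥-elim (≡true⇒≢false split not-split)
... | inj₂ merge = merge

cellOf⁺ : ∀ L c → c ∈ L → (∀ {x} → x ∈ L → lcell x ≡ lcell c → x ≡ c) → candidate L c ≡ true →
          (∀ {y} → y ∈ L → candidate L y ≡ true → lcell y ≡ lcell c ⊎ ltᶜ y c ≡ true) →
          cellOf L ≡ just c
cellOf⁺ L c c∈L unique cand greatest = greatest⇒maxCell _ c (∈-filterᵇ⁺ (candidate L) c∈L cand)
  (unique ∘ proj₁ ∘ ∈-filterᵇ⁻ (candidate L))
  (greatest′ ∘ ∈-filterᵇ⁻ (candidate L))
  where
  greatest′ : ∀ {y} → y ∈ L × candidate L y ≡ true → y ≈ᶜ c ⊎ ltᶜ y c ≡ true
  greatest′ (y∈L , cand-y) with greatest y∈L cand-y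
  ... | inj₂ y<c = inj₂ y<c
  ... | inj₁ same with unique y∈L same
  ... | refl = inj₁ (refl , refl)

module WellFormed (mu : Partition) (k : ℕ) (L : List LCell) (distinct : DistinctCells L)
                  (outside : ∀ {x} → x ∈ L → ¬ InDiagram mu (lcell x)) (valid : ValidFilling mu k L) where

  bounds : ∀ {x} → x ∈ L → (1 ≤ blk x × blk x ≤ k) × 1 ≤ ent x
  bounds = All.lookup (proj₁ valid)

  blk≥1 : ∀ {x} → x ∈ L → 1 ≤ blk x
  blk≥1 = proj₁ ∘ proj₁ ∘ bounds

  blk≤k : ∀ {x} → x ∈ L → blk x ≤ k
  blk≤k = proj₂ ∘ proj₁ ∘ bounds

  block-nonempty : ∀ b → 1 ≤ b → b ≤ k → ∃ λ x → x ∈ L × blk x ≡ b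
  block-nonempty b 1≤b b≤k = find (proj₁ (proj₂ valid) b 1≤b b≤k)

  level-diagram : ∀ i → i ≤ k → IsDiagram (Level mu L i)
  level-diagram = proj₁ (proj₂ (proj₂ valid))

  cell-injective : ∀ {x y} → x ∈ L → y ∈ L → lcell x ≡ lcell y → x ≡ y
  cell-injective = lcell-injective distinct

  sameBlock-compatible : ∀ {x z} → x ∈ L → z ∈ L → blk x ≡ blk z → Compatible x z
  sameBlock-compatible {x} x∈L z∈L same = SemistandardSet⁻
    (proj₂ (proj₂ (proj₂ valid)) (blk x) (blk≥1 x∈L) (blk≤k x∈L))
    (∈-blockOf⁺ x∈L refl) (∈-blockOf⁺ z∈L (sym same))

  in-own-level : ∀ {x} → x ∈ L → Level mu L (blk x) (lcell x)
  in-own-level x∈L = inj₂ (lose x∈L (refl , ≤-refl))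

  not-in-earlier-level : ∀ {i z} → z ∈ L → i < blk z → ¬ Level mu L i (lcell z)
  not-in-earlier-level z∈L _ (inj₁ inMu) = outside z∈L inMu
  not-in-earlier-level z∈L i<z (inj₂ some) with find some
  ... | w , w∈L , same , w≤i with cell-injective w∈L z∈L same
  ... | refl = <⇒≱ i<z w≤i

  not-weaklyLeft-in-level : ∀ {i p z} → i ≤ k → Level mu L i p → z ∈ L → i < blk z →
                            row (lcell z) ≡ row p → col (lcell z) ≤ col p → ⊥
  not-weaklyLeft-in-level {i} i≤k p∈ z∈L i<z refl left =
    not-in-earlier-level z∈L i<z (IsDiagram-leftClosed (level-diagram i i≤k) left p∈)

  not-weaklyAbove-in-level : ∀ {i p z} → i ≤ k → Level mu L i p → z ∈ L → i < blk z →
                             col (lcell z) ≡ col p → row (lcell z) ≤ row p → ⊥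
  not-weaklyAbove-in-level {i} {_ , _} i≤k p∈ z∈L i<z refl above =
    not-in-earlier-level z∈L i<z (IsDiagram-upClosed (level-diagram i i≤k) above p∈)

  laterBlock-compatible : ∀ {x z} → x ∈ L → z ∈ L → blk x < blk z → Compatible z x
  laterBlock-compatible x∈L z∈L x<z =
    (λ row≡ col< → ⊥-elim (not-weaklyLeft-in-level (blk≤k x∈L) (in-own-level x∈L) z∈L x<z row≡ (<⇒≤ col<))) ,
    (λ col≡ row< → ⊥-elim (not-weaklyAbove-in-level (blk≤k x∈L) (in-own-level x∈L) z∈L x<z col≡ (<⇒≤ row<)))

  mergeable⁺ : ∀ {y} → y ∈ L → 1 < blk y → length (blockOf (blk y) L) ≡ 1 →
               (∀ {d} → d ∈ blockOf (blk y ∸ 1) L → ltᶜ d y ≡ true) → mergeable L y ≡ true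
  mergeable⁺ {y} y∈L 1<y single largest =
    ∧≡true⁺ (<⇒<ᵇ≡true 1<y) (∧≡true⁺ (≡⇒≡ᵇ≡true single)
      (∧≡true⁺ (ssytᵇ⁺ _ (λ x∈ z∈ → compatible (∈-merged x∈) (∈-merged z∈))) (allᵇ⁺ _ _ largest)))
    where
    previous = blockOf (blk y ∸ 1) L
    own = blockOf (blk y) L
    ∈-merged : ∀ {x} → x ∈ previous ++ᵇ own → x ∈ previous ⊎ x ∈ own
    ∈-merged {x} x∈ = ∈-++⁻ previous (subst (x ∈_) (++ᵇ≡++ previous own) x∈)
    only-y : ∀ {x} → x ∈ own → x ≡ y
    only-y x∈ = length≡1⇒≡ own single x∈ (∈-blockOf⁺ y∈L refl)
    before-y : ∀ {x} → x ∈ previous → blk x < blk y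
    before-y x∈ = subst (_< blk y) (sym (proj₂ (∈-blockOf⁻ L x∈)))
                        (∸-monoʳ-< {blk y} {1} {0} (s≤s z≤n) (<⇒≤ 1<y))
    sameBlock : ∀ {b x z} → x ∈ blockOf b L → z ∈ blockOf b L → Compatible x z
    sameBlock x∈ z∈ = sameBlock-compatible (proj₁ (∈-blockOf⁻ L x∈)) (proj₁ (∈-blockOf⁻ L z∈))
      (trans (proj₂ (∈-blockOf⁻ L x∈)) (sym (proj₂ (∈-blockOf⁻ L z∈))))
    compatible : ∀ {x z} → x ∈ previous ⊎ x ∈ own → z ∈ previous ⊎ z ∈ own → Compatible x z
    compatible (inj₁ x∈) (inj₁ z∈) = sameBlock x∈ z∈
    compatible (inj₂ x∈) (inj₂ z∈) = sameBlock x∈ z∈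
    compatible {x} (inj₁ x∈) (inj₂ z∈) with only-y z∈
    ... | refl = ≺⇒Compatible x y (ltᶜ⇒≺ x y (largest x∈))
    compatible (inj₂ x∈) (inj₁ z∈) with only-y x∈
    ... | refl = laterBlock-compatible (proj₁ (∈-blockOf⁻ L z∈)) y∈L (before-y z∈)

-- Relabelling blocks

reblock : (LCell → ℕ) → LCell → LCell
reblock f x = (lcell x , f x , ent x)

module Reblock (f : LCell → ℕ) (L : List LCell) where

  private
    g = reblock f
    L′ = map g L

  BlocksCorrespond : ℕ → ℕ → Set
  BlocksCorrespond j j₀ = ∀ {x} → x ∈ L → f x ≡ j ⇔ blk x ≡ j₀

  blockOf-reblock : ∀ {j j₀} → BlocksCorrespond j j₀ → blockOf j L′ ≡ map g (blockOf j₀ L)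
  blockOf-reblock corr = trans (filterᵇ-map _ g L) (cong (map g) (filterᵇ-cong-∈ _ _ L (≡ᵇ-cong ∘ corr)))

  length-blockOf-reblock : ∀ {j j₀} → BlocksCorrespond j j₀ → length (blockOf j L′) ≡ length (blockOf j₀ L)
  length-blockOf-reblock {j₀ = j₀} corr = trans (cong length (blockOf-reblock corr)) (length-map g (blockOf j₀ L))

  splittable-reblock : ∀ y {j j₀} → f y ≡ j → blk y ≡ j₀ → BlocksCorrespond j j₀ →
                       splittable L′ (g y) ≡ splittable L y
  splittable-reblock y refl refl corr = cong₂ _∧_
    (trans (cong ((1 <ᵇ_) ∘ length) block′) (cong (1 <ᵇ_) (length-map g (blockOf (blk y) L))))
    (trans (cong (allᵇ largest) block′) (allᵇ-map largest g (blockOf (blk y) L)))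
    where
    block′ = blockOf-reblock corr
    largest : LCell → Bool
    largest d = sameCell (lcell d) (lcell y) ∨ ltᶜ d (g y)

  mergeable-reblock : ∀ y {j j₀} → f y ≡ j → blk y ≡ j₀ → BlocksCorrespond j j₀ →
                      BlocksCorrespond (j ∸ 1) (j₀ ∸ 1) → (1 < j ⇔ 1 < j₀) → mergeable L′ (g y) ≡ mergeable L y
  mergeable-reblock y refl refl corr corr-previous late = cong₂ _∧_ (<ᵇ-cong late) (cong₂ _∧_
    (trans (cong ((_≡ᵇ 1) ∘ length) own′) (cong (_≡ᵇ 1) (length-map g own)))
    (cong₂ _∧_
      (begin
        ssytᵇ (blockOf (f y ∸ 1) L′ ++ᵇ blockOf (f y) L′)
          ≡⟨ cong₂ (λ P S → ssytᵇ (P ++ᵇ S)) previous′ own′ ⟩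
        ssytᵇ (map g previous ++ᵇ map g own)             ≡⟨ cong ssytᵇ (++ᵇ≡++ (map g previous) (map g own)) ⟩
        ssytᵇ (map g previous ++ map g own)              ≡⟨ cong ssytᵇ (sym (map-++ g previous own)) ⟩
        ssytᵇ (map g (previous ++ own))                  ≡⟨ ssytᵇ-reblock (previous ++ own) ⟩
        ssytᵇ (previous ++ own)                          ≡⟨ cong ssytᵇ (sym (++ᵇ≡++ previous own)) ⟩
        ssytᵇ (previous ++ᵇ own)                         ∎)
      (trans (cong (allᵇ (λ d → ltᶜ d (g y))) previous′) (allᵇ-map (λ d → ltᶜ d (g y)) g previous))))
    where
    open ≡-Reasoning
    own = blockOf (blk y) L
    previous = blockOf (blk y ∸ 1) L
    own′ = blockOf-reblock corr
    previous′ = blockOf-reblock corr-previous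
    ssytᵇ-reblock : ∀ X → ssytᵇ (map g X) ≡ ssytᵇ X
    ssytᵇ-reblock X = trans (allᵇ-map _ g X) (allᵇ-cong _ _ X (λ x → allᵇ-map (compatibleᵇ (g x)) g X))

  candidate-reblock : ∀ y {j j₀} → f y ≡ j → blk y ≡ j₀ → BlocksCorrespond j j₀ →
                      BlocksCorrespond (j ∸ 1) (j₀ ∸ 1) → (1 < j ⇔ 1 < j₀) → candidate L′ (g y) ≡ candidate L y
  candidate-reblock y fy by corr corr-previous late =
    cong₂ _∨_ (splittable-reblock y fy by corr) (mergeable-reblock y fy by corr corr-previous late)

  cellOf-reblock : DistinctCells L → ∀ {c} → c ∈ L → candidate L′ (g c) ≡ true →
    (∀ {y} → y ∈ L → lcell y ≢ lcell c → candidate L′ (g y) ≡ true → ltᶜ y c ≡ true) →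
    cellOf L′ ≡ just (g c)
  cellOf-reblock distinct {c} c∈L cand-c others-below =
    cellOf⁺ L′ (g c) (∈-map⁺ g c∈L) unique cand-c greatest
    where
    unique : ∀ {x′} → x′ ∈ L′ → lcell x′ ≡ lcell (g c) → x′ ≡ g c
    unique x′∈ same with ∈-map⁻ g x′∈
    ... | x , x∈L , refl = cong g (lcell-injective distinct x∈L c∈L same)
    greatest : ∀ {y′} → y′ ∈ L′ → candidate L′ y′ ≡ true →
               lcell y′ ≡ lcell (g c) ⊎ ltᶜ y′ (g c) ≡ true
    greatest y′∈ cand with ∈-map⁻ g y′∈
    ... | y , y∈L , refl with lcell y ≟ᶜ lcell c
    ... | yes same = inj₁ same
    ... | no differ = inj₂ (others-below y∈L differ cand)

  ∈-blockOf-reblock⁻ : ∀ {j x′} → x′ ∈ blockOf j L′ → ∃ λ x → x ∈ L × x′ ≡ g x × f x ≡ j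
  ∈-blockOf-reblock⁻ x′∈ with ∈-blockOf⁻ L′ x′∈
  ... | x′∈L′ , in-j with ∈-map⁻ g x′∈L′
  ... | x , x∈L , refl = x , x∈L , refl , in-j

  ∈-blockOf-reblock⁺ : ∀ {j x} → x ∈ L → f x ≡ j → g x ∈ blockOf j L′
  ∈-blockOf-reblock⁺ x∈L in-j = ∈-blockOf⁺ (∈-map⁺ g x∈L) in-j

  Level-reblock⁻ : ∀ mu {i p} → Level mu L′ i p → InDiagram mu p ⊎ ∃ λ x → x ∈ L × lcell x ≡ p × f x ≤ i
  Level-reblock⁻ _ (inj₁ inMu) = inj₁ inMu
  Level-reblock⁻ _ (inj₂ some) = inj₂ (find (Any.map⁻ some))

  Level-reblock⁺ : ∀ mu {i p} → InDiagram mu p ⊎ (∃ λ x → x ∈ L × lcell x ≡ p × f x ≤ i) →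
                   Level mu L′ i p
  Level-reblock⁺ _ (inj₁ inMu) = inj₁ inMu
  Level-reblock⁺ _ (inj₂ (_ , x∈L , at-p)) = inj₂ (Any.map⁺ (lose x∈L at-p))

  level-reblock : ∀ mu i j → (∀ {x} → x ∈ L → f x ≤ i ⇔ blk x ≤ j) →
                  IsDiagram (Level mu L j) → IsDiagram (Level mu L′ i)
  level-reblock mu i j same-levels = IsDiagram-cong to from
    where
    to : ∀ {p} → Level mu L′ i p → Level mu L j p
    to p∈ with Level-reblock⁻ mu p∈
    ... | inj₁ inMu = inj₁ inMu
    ... | inj₂ (x , x∈L , at-p , x≤i) =
      Level⁺ mu (inj₂ (x , x∈L , at-p , Equivalence.to (same-levels x∈L) x≤i))
    from : ∀ {p} → Level mu L j p → Level mu L′ i p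
    from p∈ with Level⁻ mu p∈
    ... | inj₁ inMu = inj₁ inMu
    ... | inj₂ (x , x∈L , at-p , x≤j) =
      Level-reblock⁺ mu (inj₂ (x , x∈L , at-p , Equivalence.from (same-levels x∈L) x≤j))

  level-reblock-without : ∀ mu i j (c : Cell) → ¬ InDiagram mu c →
    (∀ {x} → x ∈ L → f x ≤ i ⇔ (blk x ≤ j × lcell x ≢ c)) →
    IsDiagram (λ p → Level mu L j p × p ≢ c) → IsDiagram (Level mu L′ i)
  level-reblock-without mu i j c c∉mu same-levels = IsDiagram-cong to from
    where
    to : ∀ {p} → Level mu L′ i p → Level mu L j p × p ≢ c
    to p∈ with Level-reblock⁻ mu p∈
    ... | inj₁ inMu = inj₁ inMu , λ { refl → c∉mu inMu }
    ... | inj₂ (x , x∈L , refl , x≤i) with Equivalence.to (same-levels x∈L) x≤i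
    ... | x≤j , x≢c = Level⁺ mu (inj₂ (x , x∈L , refl , x≤j)) , x≢c
    from : ∀ {p} → Level mu L j p × p ≢ c → Level mu L′ i p
    from (p∈ , p≢c) with Level⁻ mu p∈
    ... | inj₁ inMu = inj₁ inMu
    ... | inj₂ (x , x∈L , refl , x≤j) =
      Level-reblock⁺ mu (inj₂ (x , x∈L , refl , Equivalence.from (same-levels x∈L) (x≤j , p≢c)))

  ValidFilling-reblock : ∀ mu k′ →
    (∀ {x} → x ∈ L → (1 ≤ f x × f x ≤ k′) × 1 ≤ ent x) →
    (∀ j → 1 ≤ j → j ≤ k′ → ∃ λ x → x ∈ L × f x ≡ j) →
    (∀ i → i ≤ k′ → IsDiagram (Level mu L′ i)) →
    (∀ {x z} → x ∈ L → z ∈ L → f x ≡ f z → Compatible x z) →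
    ValidFilling mu k′ L′
  ValidFilling-reblock mu k′ bounds surjective diagrams compatible =
      All.map⁺ (All.tabulate bounds)
    , (λ j 1≤j j≤k′ → let (x , x∈L , fx≡j) = surjective j 1≤j j≤k′ in Any.map⁺ (lose x∈L fx≡j))
    , diagrams
    , (λ j _ _ → SemistandardSet⁺ λ x∈ z∈ → sameBlock (∈-blockOf-reblock⁻ x∈) (∈-blockOf-reblock⁻ z∈))
    where
    sameBlock : ∀ {j x′ z′} → (∃ λ x → x ∈ L × x′ ≡ g x × f x ≡ j) →
                (∃ λ z → z ∈ L × z′ ≡ g z × f z ≡ j) → Compatible x′ z′
    sameBlock (x , x∈L , refl , fx≡j) (z , z∈L , refl , fz≡j) = compatible x∈L z∈L (trans fx≡j (sym fz≡j))

  DistinctCells-reblock : DistinctCells L → DistinctCells L′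
  DistinctCells-reblock = subst Unique (map-∘ L)

  outside-reblock : ∀ {mu} → (∀ {x} → x ∈ L → ¬ InDiagram mu (lcell x)) →
                    ∀ {x′} → x′ ∈ L′ → ¬ InDiagram mu (lcell x′)
  outside-reblock outside x′∈ with ∈-map⁻ g x′∈
  ... | x , x∈L , refl = outside x∈L

-- Splitting and merging at cell(T)

-- The relabellings performed by Φ, verbatim.
splitBlock : LCell → LCell → ℕ
splitBlock c x = if sameCell (lcell x) (lcell c) then suc (blk c)
                 else if blk c <ᵇ blk x then suc (blk x) else blk x

mergeBlock : LCell → LCell → ℕ
mergeBlock c x = if sameCell (lcell x) (lcell c) then blk c ∸ 1
                 else if blk c <ᵇ blk x then blk x ∸ 1 else blk x

module Split (mu : Partition) (k : ℕ) (L : List LCell) (distinct : DistinctCells L)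
             (outside : ∀ {x} → x ∈ L → ¬ InDiagram mu (lcell x)) (valid : ValidFilling mu k L)
             (c : LCell) (cell≡c : cellOf L ≡ just c) (split : splittable L c ≡ true) where

  open WellFormed mu k L distinct outside valid
  open Reblock (splitBlock c) L

  private
    b = blk c
    f = splitBlock c
    g = reblock f
    L′ = map g L

  c∈L : c ∈ L
  c∈L = proj₁ (cellOf⁻ L c cell≡c)

  b≥1 : 1 ≤ b
  b≥1 = blk≥1 c∈L

  c-largest-in-block : ∀ {d} → d ∈ L → blk d ≡ b → lcell d ≢ lcell c → ltᶜ d c ≡ true
  c-largest-in-block d∈L d∈b = proj₂ (splittable⁻ L c split) (∈-blockOf⁺ d∈L d∈b)

  c-rightmost-in-block : ∀ {w} → w ∈ L → blk w ≡ b →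
                         row (lcell w) ≡ row (lcell c) → col (lcell c) < col (lcell w) → ⊥
  c-rightmost-in-block {w} w∈L w∈b same-row c<w
    with ltᶜ⇒≺ w c (c-largest-in-block w∈L w∈b λ same → <-irrefl (cong col (sym same)) c<w)
  ... | inj₁ e< = <⇒≱ e< (proj₁ (sameBlock-compatible c∈L w∈L (sym w∈b)) (sym same-row) c<w)
  ... | inj₂ (_ , inj₁ w<c) = <-asym w<c c<w
  ... | inj₂ (_ , inj₂ (same-col , _)) = <-irrefl (sym same-col) c<w

  c-lowest-in-block : ∀ {w} → w ∈ L → blk w ≡ b →
                      col (lcell w) ≡ col (lcell c) → row (lcell c) < row (lcell w) → ⊥
  c-lowest-in-block {w} w∈L w∈b same-col c<w
    with ltᶜ⇒≺ w c (c-largest-in-block w∈L w∈b λ same → <-irrefl (cong row (sym same)) c<w)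
  ... | inj₁ e< = <-asym e< (proj₂ (sameBlock-compatible c∈L w∈L (sym w∈b)) (sym same-col) c<w)
  ... | inj₂ (e≡ , _) = <-irrefl (sym e≡) (proj₂ (sameBlock-compatible c∈L w∈L (sym w∈b)) (sym same-col) c<w)

  c-no-right-neighbour : ∀ {i} → i ≤ b → ¬ Level mu L i (row (lcell c) , suc (col (lcell c)))
  c-no-right-neighbour i≤b p∈ with Level⁻ mu p∈
  ... | inj₁ inMu = not-weaklyLeft-in-level z≤n (inj₁ inMu) c∈L b≥1 refl (n≤1+n _)
  ... | inj₂ (w , w∈L , w-at , w≤i) with m≤n⇒m<n∨m≡n (≤-trans w≤i i≤b)
  ... | inj₁ w<b = not-weaklyLeft-in-level (blk≤k w∈L) (subst (Level mu L (blk w)) w-at (in-own-level w∈L))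
                     c∈L w<b refl (n≤1+n _)
  ... | inj₂ w∈b = c-rightmost-in-block w∈L w∈b (cong row w-at) (subst (col (lcell c) <_) (sym (cong col w-at)) ≤-refl)

  c-no-lower-neighbour : ∀ {i} → i ≤ b → ¬ Level mu L i (suc (row (lcell c)) , col (lcell c))
  c-no-lower-neighbour i≤b p∈ with Level⁻ mu p∈
  ... | inj₁ inMu = not-weaklyAbove-in-level z≤n (inj₁ inMu) c∈L b≥1 refl (n≤1+n _)
  ... | inj₂ (w , w∈L , w-at , w≤i) with m≤n⇒m<n∨m≡n (≤-trans w≤i i≤b)
  ... | inj₁ w<b = not-weaklyAbove-in-level (blk≤k w∈L) (subst (Level mu L (blk w)) w-at (in-own-level w∈L))
                     c∈L w<b refl (n≤1+n _)
  ... | inj₂ w∈b = c-lowest-in-block w∈L w∈b (cong col w-at) (subst (row (lcell c) <_) (sym (cong row w-at)) ≤-refl)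

  level-without-c : ∀ i → i ≤ b → IsDiagram (λ p → Level mu L i p × p ≢ lcell c)
  level-without-c i i≤b =
    (λ r j (p∈ , _) → proj₁ diagram r j p∈ , λ at-c →
       c-no-right-neighbour i≤b (subst (λ q → Level mu L i (proj₁ q , suc (proj₂ q))) at-c p∈)) ,
    (λ r j (p∈ , _) → proj₂ diagram r j p∈ , λ at-c →
       c-no-lower-neighbour i≤b (subst (λ q → Level mu L i (suc (proj₁ q) , proj₂ q)) at-c p∈))
    where
    diagram : IsDiagram (Level mu L i)
    diagram = level-diagram i (≤-trans i≤b (blk≤k c∈L))

  splitBlock-c : f c ≡ suc b
  splitBlock-c = if-true (≡⇒sameCell≡true (lcell c) (lcell c) refl)

  splitBlock-earlier : ∀ x → lcell x ≢ lcell c → blk x ≤ b → f x ≡ blk x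
  splitBlock-earlier x x≢c x≤b = trans (if-false (≢⇒sameCell≡false _ _ x≢c)) (if-false (≥⇒<ᵇ≡false x≤b))

  splitBlock-later : ∀ x → lcell x ≢ lcell c → b < blk x → f x ≡ suc (blk x)
  splitBlock-later x x≢c b<x = trans (if-false (≢⇒sameCell≡false _ _ x≢c)) (if-true (<⇒<ᵇ≡true b<x))

  data SplitView (x : LCell) : Set where
    self    : x ≡ c → SplitView x
    later   : lcell x ≢ lcell c → b < blk x → f x ≡ suc (blk x) → SplitView x
    earlier : lcell x ≢ lcell c → blk x ≤ b → f x ≡ blk x → SplitView x

  splitView : ∀ {x} → x ∈ L → SplitView x
  splitView {x} x∈L with lcell x ≟ᶜ lcell c | <-≤-connex b (blk x)
  ... | yes same | _ = self (cell-injective x∈L c∈L same)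
  ... | no x≢c | inj₁ b<x = later x≢c b<x (splitBlock-later x x≢c b<x)
  ... | no x≢c | inj₂ x≤b = earlier x≢c x≤b (splitBlock-earlier x x≢c x≤b)

  unsplit : ℕ → ℕ
  unsplit n = if b <ᵇ n then n ∸ 1 else n

  unsplit-splitBlock : ∀ {x} → x ∈ L → unsplit (f x) ≡ blk x
  unsplit-splitBlock x∈L with splitView x∈L
  ... | self refl rewrite splitBlock-c = if-true (<⇒<ᵇ≡true (n<1+n b))
  ... | later _ b<x fx rewrite fx = if-true (<⇒<ᵇ≡true (m<n⇒m<1+n b<x))
  ... | earlier _ x≤b fx rewrite fx = if-false (≥⇒<ᵇ≡false x≤b)

  splitBlock-reflects-blocks : ∀ {x z} → x ∈ L → z ∈ L → f x ≡ f z → blk x ≡ blk z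
  splitBlock-reflects-blocks x∈L z∈L fx≡fz =
    trans (sym (unsplit-splitBlock x∈L)) (trans (cong unsplit fx≡fz) (unsplit-splitBlock z∈L))

  split-keeps-earlier : ∀ {t} → t < b → BlocksCorrespond t t
  split-keeps-earlier {t} t<b {x} x∈L = mk⇔
    (λ fx≡t → trans (sym (unsplit-splitBlock x∈L))
                    (trans (cong unsplit fx≡t) (if-false (≥⇒<ᵇ≡false (<⇒≤ t<b)))))
    (λ x∈t → trans (splitBlock-earlier x (x≢c x∈t) (<⇒≤ (subst (_< b) (sym x∈t) t<b))) x∈t)
    where
    x≢c : blk x ≡ t → lcell x ≢ lcell c
    x≢c x∈t same = <-irrefl (trans (sym x∈t) (cong blk (cell-injective x∈L c∈L same))) t<b

  split-shifts-later : ∀ t → b < pred t → BlocksCorrespond t (pred t)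
  split-shifts-later zero ()
  split-shifts-later (suc t) b<t {x} x∈L = mk⇔
    (λ fx≡1+t → trans (sym (unsplit-splitBlock x∈L))
                      (trans (cong unsplit fx≡1+t) (if-true (<⇒<ᵇ≡true (m<n⇒m<1+n b<t)))))
    (λ x∈t → trans (splitBlock-later x (x≢c x∈t) (subst (b <_) (sym x∈t) b<t)) (cong suc x∈t))
    where
    x≢c : blk x ≡ t → lcell x ≢ lcell c
    x≢c x∈t same = <-irrefl (trans (cong blk (sym (cell-injective x∈L c∈L same))) x∈t) b<t

  splitBlock-bounds : ∀ {x} → x ∈ L → 1 ≤ f x × f x ≤ suc k
  splitBlock-bounds x∈L with splitView x∈L
  ... | self refl rewrite splitBlock-c = s≤s z≤n , s≤s (blk≤k c∈L)
  ... | later _ _ fx rewrite fx = s≤s z≤n , s≤s (blk≤k x∈L)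
  ... | earlier _ _ fx rewrite fx = blk≥1 x∈L , m≤n⇒m≤1+n (blk≤k x∈L)

  splitBlock-surjective : ∀ j → 1 ≤ j → j ≤ suc k → ∃ λ x → x ∈ L × f x ≡ j
  splitBlock-surjective j 1≤j j≤1+k with <-cmp j b
  ... | tri< j<b _ _ with block-nonempty j 1≤j (≤-trans (<⇒≤ j<b) (blk≤k c∈L))
  ... | x , x∈L , x∈j = x , x∈L , Equivalence.from (split-keeps-earlier j<b x∈L) x∈j
  splitBlock-surjective j 1≤j j≤1+k | tri≈ _ refl _
    with ∃-other-∈-filterᵇ _ distinct (proj₁ (splittable⁻ L c split)) (lcell c)
  ... | x , x∈L , x∈b , x≢c = x , x∈L , trans (splitBlock-earlier x x≢c (≤-reflexive x∈b′)) x∈b′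
    where
    x∈b′ : blk x ≡ b
    x∈b′ = ≡ᵇ≡true⇒≡ _ _ x∈b
  splitBlock-surjective (suc j) 1≤j j≤1+k | tri> _ _ b<1+j with m≤n⇒m<n∨m≡n b<1+j
  ... | inj₂ refl = c , c∈L , splitBlock-c
  ... | inj₁ (s≤s b<j) with block-nonempty j (≤-trans b≥1 (<⇒≤ b<j)) (≤-pred j≤1+k)
  ... | x , x∈L , x∈j = x , x∈L , Equivalence.from (split-shifts-later (suc j) b<j x∈L) x∈j

  split-level-diagram : ∀ i → i ≤ suc k → IsDiagram (Level mu L′ i)
  split-level-diagram i _ with ≤-<-connex i b
  ... | inj₁ i≤b = level-reblock-without mu i i (lcell c) (outside c∈L) same-levels (level-without-c i i≤b)
    where
    same-levels : ∀ {x} → x ∈ L → f x ≤ i ⇔ (blk x ≤ i × lcell x ≢ lcell c)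
    same-levels x∈L with splitView x∈L
    ... | self refl rewrite splitBlock-c =
      mk⇔ (λ b<i → ⊥-elim (<⇒≱ b<i i≤b)) (λ (_ , c≢c) → ⊥-elim (c≢c refl))
    ... | later _ b<x fx rewrite fx =
      mk⇔ (λ x<i → ⊥-elim (<⇒≱ (<-trans b<x x<i) i≤b))
          (λ (x≤i , _) → ⊥-elim (<⇒≱ b<x (≤-trans x≤i i≤b)))
    ... | earlier x≢c _ fx rewrite fx = mk⇔ (_, x≢c) proj₁
  split-level-diagram zero _ | inj₂ ()
  split-level-diagram (suc i) 1+i≤1+k | inj₂ (s≤s b≤i) =
    level-reblock mu (suc i) i same-levels (level-diagram i (≤-pred 1+i≤1+k))
    where
    same-levels : ∀ {x} → x ∈ L → f x ≤ suc i ⇔ blk x ≤ i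
    same-levels x∈L with splitView x∈L
    ... | self refl rewrite splitBlock-c = mk⇔ ≤-pred s≤s
    ... | later _ _ fx rewrite fx = mk⇔ ≤-pred s≤s
    ... | earlier _ x≤b fx rewrite fx =
      mk⇔ (λ _ → ≤-trans x≤b b≤i) (λ _ → m≤n⇒m≤1+n (≤-trans x≤b b≤i))

  split-valid : ValidFilling mu (suc k) L′
  split-valid = ValidFilling-reblock mu (suc k)
    (λ x∈L → splitBlock-bounds x∈L , proj₂ (bounds x∈L))
    splitBlock-surjective
    split-level-diagram
    (λ x∈L z∈L fx≡fz → sameBlock-compatible x∈L z∈L (splitBlock-reflects-blocks x∈L z∈L fx≡fz))

  module AfterSplit = WellFormed mu (suc k) L′ (DistinctCells-reblock distinct) (outside-reblock {mu} outside) split-valid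

  splitBlock≡1+b⇒c : ∀ {x} → x ∈ L → f x ≡ suc b → lcell x ≡ lcell c
  splitBlock≡1+b⇒c x∈L fx≡1+b with splitView x∈L
  ... | self refl = refl
  ... | later _ b<x fx = ⊥-elim (<-irrefl (suc-injective (trans (sym fx≡1+b) fx)) b<x)
  ... | earlier _ x≤b fx = ⊥-elim (<⇒≱ (n<1+n b) (subst (_≤ b) (trans (sym fx) fx≡1+b) x≤b))

  splitBlock≡b⇒∈b∖c : ∀ {x} → x ∈ L → f x ≡ b → blk x ≡ b × lcell x ≢ lcell c
  splitBlock≡b⇒∈b∖c x∈L fx≡b with splitView x∈L
  ... | self refl = ⊥-elim (1+n≢n (trans (sym splitBlock-c) fx≡b))
  ... | later _ b<x fx = ⊥-elim (<-asym b<x (subst (_ <_) (trans (sym fx) fx≡b) (n<1+n _)))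
  ... | earlier x≢c _ fx = trans (sym fx) fx≡b , x≢c

  c-alone-after : length (blockOf (f c) L′) ≡ 1
  c-alone-after = begin
    length (blockOf (f c) L′)                      ≡⟨ cong length (filterᵇ-map _ g L) ⟩
    length (map g (filterᵇ (λ x → f x ≡ᵇ f c) L))  ≡⟨ length-map g (filterᵇ (λ x → f x ≡ᵇ f c) L) ⟩
    length (filterᵇ (λ x → f x ≡ᵇ f c) L)
      ≡⟨ length-filterᵇ≡1 _ distinct c∈L only-c (≡⇒≡ᵇ≡true {f c} refl) ⟩
    1                                              ∎
    where
    open ≡-Reasoning
    only-c : ∀ {x} → x ∈ L → (f x ≡ᵇ f c) ≡ true → lcell x ≡ lcell c
    only-c x∈L fx≡fc = splitBlock≡1+b⇒c x∈L (trans (≡ᵇ≡true⇒≡ _ _ fx≡fc) splitBlock-c)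

  c-not-splittable-after : splittable L′ (g c) ≡ false
  c-not-splittable-after = ≢true⇒≡false λ split′ →
    <-irrefl refl (subst (1 <_) c-alone-after (proj₁ (splittable⁻ L′ (g c) split′)))

  c-mergeable-after : mergeable L′ (g c) ≡ true
  c-mergeable-after = AfterSplit.mergeable⁺ (∈-map⁺ g c∈L) (subst (1 <_) (sym splitBlock-c) (s≤s b≥1))
    c-alone-after largest
    where
    largest : ∀ {d′} → d′ ∈ blockOf (f c ∸ 1) L′ → ltᶜ d′ (g c) ≡ true
    largest d′∈ with ∈-blockOf-reblock⁻ d′∈
    ... | x , x∈L , refl , fx≡ with splitBlock≡b⇒∈b∖c x∈L (trans fx≡ (cong (_∸ 1) splitBlock-c))
    ... | x∈b , x≢c = c-largest-in-block x∈L x∈b x≢c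

  next-block-candidate : ∀ {y} → y ∈ L → blk y ≡ suc b → candidate L′ (g y) ≡ true → candidate L y ≡ true
  next-block-candidate {y} y∈L y∈1+b cand′ = [ splittable-before , mergeable-before ]′ (∨≡true⁻ _ cand′)
    where
    b<y : b < blk y
    b<y = subst (b <_) (sym y∈1+b) (n<1+n b)
    fy : f y ≡ suc (blk y)
    fy = Equivalence.from (split-shifts-later (suc (blk y)) b<y y∈L) refl
    splittable-before : splittable L′ (g y) ≡ true → candidate L y ≡ true
    splittable-before split′ =
      ∨≡trueˡ _ (trans (sym (splittable-reblock y fy refl (split-shifts-later (suc (blk y)) b<y))) split′)
    mergeable-before : mergeable L′ (g y) ≡ true → candidate L y ≡ true
    mergeable-before merge′ with mergeable⁻ L′ (g y) merge′
    ... | _ , single′ , _ , previous-below-y′ =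
      ∨≡trueʳ (splittable L y) (mergeable⁺ y∈L (≤-<-trans b≥1 b<y) single largest)
      where
      single : length (blockOf (blk y) L) ≡ 1
      single = trans (sym (length-blockOf-reblock (split-shifts-later (suc (blk y)) b<y)))
                     (subst (λ j → length (blockOf j L′) ≡ 1) fy single′)
      c<y : ltᶜ c y ≡ true
      c<y = previous-below-y′ (∈-blockOf-reblock⁺ c∈L
              (trans splitBlock-c (trans (sym y∈1+b) (cong (_∸ 1) (sym fy)))))
      largest : ∀ {d} → d ∈ blockOf (blk y ∸ 1) L → ltᶜ d y ≡ true
      largest {d} d∈ with ∈-blockOf⁻ L d∈ | lcell d ≟ᶜ lcell c
      ... | d∈L , _ | yes same rewrite cell-injective d∈L c∈L same = c<y
      ... | d∈L , d∈b | no d≢c =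
        ltᶜ-trans d c y (c-largest-in-block d∈L (trans d∈b (cong (_∸ 1) y∈1+b)) d≢c) c<y

  others-below : ∀ {y} → y ∈ L → lcell y ≢ lcell c → candidate L′ (g y) ≡ true → ltᶜ y c ≡ true
  others-below y∈L y≢c cand′ with splitView y∈L
  ... | self refl = ⊥-elim (y≢c refl)
  ... | earlier _ y≤b fy with m≤n⇒m<n∨m≡n y≤b
  ... | inj₂ y∈b = c-largest-in-block y∈L y∈b y≢c
  ... | inj₁ y<b = cellOf-greatest L cell≡c y∈L y≢c (trans (sym (candidate-reblock _ fy refl
        (split-keeps-earlier y<b) (split-keeps-earlier (≤-<-trans (m∸n≤m _ 1) y<b)) (mk⇔ id id))) cand′)
  others-below {y} y∈L y≢c cand′ | later _ b<y fy with m≤n⇒m<n∨m≡n b<y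
  ... | inj₂ y∈1+b = cellOf-greatest L cell≡c y∈L y≢c (next-block-candidate y∈L (sym y∈1+b) cand′)
  ... | inj₁ 1+b<y = cellOf-greatest L cell≡c y∈L y≢c (trans (sym (candidate-reblock _ fy refl
        (split-shifts-later (suc (blk y)) b<y) (split-shifts-later (blk y) (<⇒≤pred 1+b<y))
        (mk⇔ (λ _ → 1<y) (λ _ → m<n⇒m<1+n 1<y)))) cand′)
    where
    1<y : 1 < blk y
    1<y = ≤-<-trans b≥1 b<y

  cellOf-split : cellOf L′ ≡ just (g c)
  cellOf-split = cellOf-reblock distinct c∈L (∨≡trueʳ (splittable L′ (g c)) c-mergeable-after) others-below

  mergeBlock-splitBlock : ∀ {x} → x ∈ L → mergeBlock (g c) (g x) ≡ blk x
  mergeBlock-splitBlock x∈L with splitView x∈L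
  ... | self refl = trans (if-true (≡⇒sameCell≡true (lcell c) (lcell c) refl)) (cong (_∸ 1) splitBlock-c)
  ... | later x≢c b<x fx = trans (if-false (≢⇒sameCell≡false _ _ x≢c))
        (trans (if-true (<⇒<ᵇ≡true (subst₂ _<_ (sym splitBlock-c) (sym fx) (s≤s b<x)))) (cong (_∸ 1) fx))
  ... | earlier x≢c x≤b fx = trans (if-false (≢⇒sameCell≡false _ _ x≢c))
        (trans (if-false (≥⇒<ᵇ≡false (subst₂ _≤_ (sym fx) (sym splitBlock-c) (m≤n⇒m≤1+n x≤b)))) fx)

module Merge (mu : Partition) (k : ℕ) (L : List LCell) (distinct : DistinctCells L)
             (outside : ∀ {x} → x ∈ L → ¬ InDiagram mu (lcell x)) (valid : ValidFilling mu k L)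
             (c : LCell) (cell≡c : cellOf L ≡ just c) (merge : mergeable L c ≡ true) where

  open WellFormed mu k L distinct outside valid
  open Reblock (mergeBlock c) L

  private
    b = blk c
    b′ = pred b
    f = mergeBlock c
    g = reblock f
    L′ = map g L
    merged = blockOf b′ L ++ᵇ blockOf b L

  c∈L : c ∈ L
  c∈L = proj₁ (cellOf⁻ L c cell≡c)

  1<b : 1 < b
  1<b = proj₁ (mergeable⁻ L c merge)

  k≥1 : 1 ≤ k
  k≥1 = ≤-trans (blk≥1 c∈L) (blk≤k c∈L)

  1+b′≡b : suc b′ ≡ b
  1+b′≡b = suc-pred b {{>-nonZero (blk≥1 c∈L)}}

  b′<b : b′ < b
  b′<b = subst (b′ <_) 1+b′≡b (n<1+n b′)

  c-alone : ∀ {x} → x ∈ L → blk x ≡ b → x ≡ c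
  c-alone x∈L x∈b =
    length≡1⇒≡ _ (proj₁ (proj₂ (mergeable⁻ L c merge))) (∈-blockOf⁺ x∈L x∈b) (∈-blockOf⁺ c∈L refl)

  previous-below-c : ∀ {d} → d ∈ L → blk d ≡ b′ → ltᶜ d c ≡ true
  previous-below-c d∈L d∈b′ = proj₂ (proj₂ (proj₂ (mergeable⁻ L c merge))) (∈-blockOf⁺ d∈L d∈b′)

  merged-compatible : ∀ {x z} → x ∈ merged → z ∈ merged → Compatible x z
  merged-compatible = ssytᵇ⁻ merged (proj₁ (proj₂ (proj₂ (mergeable⁻ L c merge))))

  mergeBlock-c : f c ≡ b′
  mergeBlock-c = if-true (≡⇒sameCell≡true (lcell c) (lcell c) refl)

  data MergeView (x : LCell) : Set where
    self    : x ≡ c → MergeView x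
    later   : lcell x ≢ lcell c → b < blk x → f x ≡ pred (blk x) → MergeView x
    earlier : lcell x ≢ lcell c → blk x ≤ b′ → f x ≡ blk x → MergeView x

  mergeView : ∀ {x} → x ∈ L → MergeView x
  mergeView {x} x∈L with lcell x ≟ᶜ lcell c | <-≤-connex b (blk x)
  ... | yes same | _ = self (cell-injective x∈L c∈L same)
  ... | no x≢c | inj₁ b<x =
    later x≢c b<x (trans (if-false (≢⇒sameCell≡false _ _ x≢c)) (if-true (<⇒<ᵇ≡true b<x)))
  ... | no x≢c | inj₂ x≤b =
    earlier x≢c x≤b′ (trans (if-false (≢⇒sameCell≡false _ _ x≢c)) (if-false (≥⇒<ᵇ≡false x≤b)))
    where
    x≤b′ : blk x ≤ b′
    x≤b′ = <⇒≤pred (≤∧≢⇒< x≤b λ x∈b → x≢c (cong lcell (c-alone x∈L x∈b)))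

  mergeBlock≡b′⇒c⊎∈b′ : ∀ {x} → x ∈ L → f x ≡ b′ → x ≡ c ⊎ blk x ≡ b′
  mergeBlock≡b′⇒c⊎∈b′ x∈L fx≡b′ with mergeView x∈L
  ... | self x≡c = inj₁ x≡c
  ... | later _ b<x fx = ⊥-elim (<⇒≱ b′<b (subst (b ≤_) (trans (sym fx) fx≡b′) (<⇒≤pred b<x)))
  ... | earlier _ _ fx = inj₂ (trans (sym fx) fx≡b′)

  mergeBlock≡b′⇒∈merged : ∀ {x} → x ∈ L → f x ≡ b′ → x ∈ merged
  mergeBlock≡b′⇒∈merged x∈L fx≡b′ with mergeBlock≡b′⇒c⊎∈b′ x∈L fx≡b′
  ... | inj₁ refl = subst (c ∈_) (sym (++ᵇ≡++ (blockOf b′ L) (blockOf b L)))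
                            (∈-++⁺ʳ (blockOf b′ L) (∈-blockOf⁺ c∈L refl))
  ... | inj₂ x∈b′ = subst (_ ∈_) (sym (++ᵇ≡++ (blockOf b′ L) (blockOf b L)))
                           (∈-++⁺ˡ (∈-blockOf⁺ x∈L x∈b′))

  merge-keeps-earlier : ∀ {t} → t < b′ → BlocksCorrespond t t
  merge-keeps-earlier t<b′ x∈L with mergeView x∈L
  ... | self refl = mk⇔ (λ fc≡t → ⊥-elim (<-irrefl (sym (trans (sym mergeBlock-c) fc≡t)) t<b′))
                        (λ b≡t → ⊥-elim (<-asym (subst (_< b′) (sym b≡t) t<b′) b′<b))
  ... | later _ b<x fx =
    mk⇔ (λ fx≡t → ⊥-elim (<⇒≱ (<-trans t<b′ b′<b) (subst (b ≤_) (trans (sym fx) fx≡t) (<⇒≤pred b<x))))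
        (λ x≡t → ⊥-elim (<-asym b<x (subst (_< b) (sym x≡t) (<-trans t<b′ b′<b))))
  ... | earlier _ _ fx = mk⇔ (trans (sym fx)) (trans fx)

  merge-shifts-later : ∀ t → b < t → BlocksCorrespond (pred t) t
  merge-shifts-later zero ()
  merge-shifts-later (suc t) b<1+t {x} x∈L with mergeView x∈L
  ... | self refl = mk⇔ (λ fc≡t → ⊥-elim (<⇒≱ b′<b (subst (b ≤_) (sym (trans (sym mergeBlock-c) fc≡t)) b≤t)))
                        (λ b≡1+t → ⊥-elim (<⇒≱ (n<1+n t) (subst (_≤ t) b≡1+t b≤t)))
    where b≤t = ≤-pred b<1+t
  ... | later _ _ fx =
    mk⇔ (λ fx≡t → trans (sym (suc-pred (blk x) {{>-nonZero (blk≥1 x∈L)}})) (cong suc (trans (sym fx) fx≡t)))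
        (λ x≡1+t → trans fx (cong pred x≡1+t))
  ... | earlier _ x≤b′ fx =
    mk⇔ (λ fx≡t → ⊥-elim (<⇒≱ (≤-<-trans x≤b′ b′<b) (subst (b ≤_) (sym (trans (sym fx) fx≡t)) b≤t)))
        (λ x≡1+t → ⊥-elim (<⇒≱ (≤-<-trans x≤b′ b′<b) (subst (b ≤_) (sym x≡1+t) (m≤n⇒m≤1+n b≤t))))
    where b≤t = ≤-pred b<1+t

  mergeBlock-bounds : ∀ {x} → x ∈ L → 1 ≤ f x × f x ≤ pred k
  mergeBlock-bounds x∈L with mergeView x∈L
  ... | self refl rewrite mergeBlock-c = <⇒≤pred 1<b , pred-mono-≤ (blk≤k c∈L)
  ... | later _ b<x fx rewrite fx = ≤-trans (<⇒≤ 1<b) (<⇒≤pred b<x) , pred-mono-≤ (blk≤k x∈L)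
  ... | earlier _ x≤b′ fx rewrite fx = blk≥1 x∈L , ≤-trans x≤b′ (pred-mono-≤ (blk≤k c∈L))

  mergeBlock-surjective : ∀ j → 1 ≤ j → j ≤ pred k → ∃ λ x → x ∈ L × f x ≡ j
  mergeBlock-surjective j 1≤j j≤k′ with <-cmp j b′
  ... | tri< j<b′ _ _ with block-nonempty j 1≤j (≤-trans (<⇒≤ (<-trans j<b′ b′<b)) (blk≤k c∈L))
  ... | x , x∈L , x∈j = x , x∈L , Equivalence.from (merge-keeps-earlier j<b′ x∈L) x∈j
  mergeBlock-surjective j 1≤j j≤k′ | tri≈ _ refl _ = c , c∈L , mergeBlock-c
  mergeBlock-surjective j 1≤j j≤k′ | tri> _ _ b′<j with block-nonempty (suc j) (s≤s z≤n) 1+j≤k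
    where
    1+j≤k : suc j ≤ k
    1+j≤k = subst (suc j ≤_) (suc-pred k {{>-nonZero k≥1}}) (s≤s j≤k′)
  ... | x , x∈L , x∈1+j = x , x∈L , Equivalence.from (merge-shifts-later (suc j) b<1+j x∈L) x∈1+j
    where
    b<1+j : b < suc j
    b<1+j = subst (_≤ suc j) (cong suc 1+b′≡b) (s≤s b′<j)

  merge-level-diagram : ∀ i → i ≤ pred k → IsDiagram (Level mu L′ i)
  merge-level-diagram i i≤k′ with <-≤-connex i b′
  ... | inj₁ i<b′ =
    level-reblock mu i i same-levels (level-diagram i (≤-trans (<⇒≤ (<-trans i<b′ b′<b)) (blk≤k c∈L)))
    where
    same-levels : ∀ {x} → x ∈ L → f x ≤ i ⇔ blk x ≤ i
    same-levels x∈L with mergeView x∈L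
    ... | self refl rewrite mergeBlock-c =
      mk⇔ (λ b′≤i → ⊥-elim (<⇒≱ i<b′ b′≤i)) (λ b≤i → ⊥-elim (<⇒≱ (<-trans i<b′ b′<b) b≤i))
    ... | later _ b<x fx rewrite fx =
      mk⇔ (λ x′≤i → ⊥-elim (<⇒≱ (<-trans i<b′ b′<b) (≤-trans (<⇒≤pred b<x) x′≤i)))
          (λ x≤i → ⊥-elim (<⇒≱ (<-trans i<b′ b′<b) (≤-trans (<⇒≤ b<x) x≤i)))
    ... | earlier _ _ fx rewrite fx = mk⇔ id id
  ... | inj₂ b′≤i = level-reblock mu i (suc i) same-levels (level-diagram (suc i) 1+i≤k)
    where
    1+i≤k : suc i ≤ k
    1+i≤k = subst (suc i ≤_) (suc-pred k {{>-nonZero k≥1}}) (s≤s i≤k′)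
    same-levels : ∀ {x} → x ∈ L → f x ≤ i ⇔ blk x ≤ suc i
    same-levels {x} x∈L with mergeView x∈L
    ... | self refl rewrite mergeBlock-c = mk⇔ (λ _ → subst (_≤ suc i) 1+b′≡b (s≤s b′≤i)) (λ _ → b′≤i)
    ... | later _ _ fx rewrite fx =
      mk⇔ (λ x′≤i → subst (_≤ suc i) (suc-pred (blk x) {{>-nonZero (blk≥1 x∈L)}}) (s≤s x′≤i)) pred-mono-≤
    ... | earlier _ x≤b′ fx rewrite fx =
      mk⇔ (λ _ → m≤n⇒m≤1+n (≤-trans x≤b′ b′≤i)) (λ _ → ≤-trans x≤b′ b′≤i)

  mergeBlock-compatible : ∀ {x z} → x ∈ L → z ∈ L → f x ≡ f z → Compatible x z
  mergeBlock-compatible {x} {z} x∈L z∈L fx≡fz with <-cmp (f x) b′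
  ... | tri< x′<b′ _ _ = sameBlock-compatible x∈L z∈L (trans
        (Equivalence.to (merge-keeps-earlier x′<b′ x∈L) refl)
        (sym (Equivalence.to (merge-keeps-earlier x′<b′ z∈L) (sym fx≡fz))))
  ... | tri≈ _ x′≡b′ _ = merged-compatible (mergeBlock≡b′⇒∈merged x∈L x′≡b′)
                                            (mergeBlock≡b′⇒∈merged z∈L (trans (sym fx≡fz) x′≡b′))
  ... | tri> _ _ b′<x′ = sameBlock-compatible x∈L z∈L (trans
        (Equivalence.to (merge-shifts-later (suc (f x)) b<1+x′ x∈L) refl)
        (sym (Equivalence.to (merge-shifts-later (suc (f x)) b<1+x′ z∈L) (sym fx≡fz))))
    where b<1+x′ = subst (_≤ suc (f x)) (cong suc 1+b′≡b) (s≤s b′<x′)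

  merge-valid : ValidFilling mu (pred k) L′
  merge-valid = ValidFilling-reblock mu (pred k)
    (λ x∈L → mergeBlock-bounds x∈L , proj₂ (bounds x∈L))
    mergeBlock-surjective
    merge-level-diagram
    mergeBlock-compatible

  mergeBlock-previous : ∀ {x} → x ∈ L → blk x ≡ b′ → f x ≡ b′
  mergeBlock-previous x∈L x∈b′ with mergeView x∈L
  ... | self refl = ⊥-elim (<-irrefl (sym x∈b′) b′<b)
  ... | later _ b<x _ = ⊥-elim (<-asym b<x (subst (_< b) (sym x∈b′) b′<b))
  ... | earlier _ _ fx = trans fx x∈b′

  c-splittable-after : splittable L′ (g c) ≡ true
  c-splittable-after with block-nonempty b′ (<⇒≤pred 1<b) (≤-trans (<⇒≤ b′<b) (blk≤k c∈L))
  ... | x , x∈L , x∈b′ = splittable⁺ L′ (g c) two largest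
    where
    two : 1 < length (blockOf (f c) L′)
    two = ≢⇒1<length _ (∈-blockOf-reblock⁺ c∈L refl)
      (∈-blockOf-reblock⁺ x∈L (trans (mergeBlock-previous x∈L x∈b′) (sym mergeBlock-c)))
      (λ gc≡gx → <-irrefl (sym (trans (cong blk (cell-injective c∈L x∈L (cong lcell gc≡gx))) x∈b′)) b′<b)
    largest : ∀ {d′} → d′ ∈ blockOf (f c) L′ → lcell d′ ≢ lcell (g c) → ltᶜ d′ (g c) ≡ true
    largest d′∈ d′≢c with ∈-blockOf-reblock⁻ d′∈
    ... | z , z∈L , refl , fz≡fc with mergeBlock≡b′⇒c⊎∈b′ z∈L (trans fz≡fc mergeBlock-c)
    ... | inj₁ refl = ⊥-elim (d′≢c refl)
    ... | inj₂ z∈b′ = previous-below-c z∈L z∈b′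

  next-block-candidate : ∀ {y} → y ∈ L → blk y ≡ suc b → candidate L′ (g y) ≡ true → candidate L y ≡ true
  next-block-candidate {y} y∈L y∈1+b cand′ = [ splittable-before , mergeable-before ]′ (∨≡true⁻ _ cand′)
    where
    b<y : b < blk y
    b<y = subst (b <_) (sym y∈1+b) (n<1+n b)
    fy : f y ≡ pred (blk y)
    fy = Equivalence.from (merge-shifts-later (blk y) b<y y∈L) refl
    splittable-before : splittable L′ (g y) ≡ true → candidate L y ≡ true
    splittable-before split′ =
      ∨≡trueˡ _ (trans (sym (splittable-reblock y fy refl (merge-shifts-later (blk y) b<y))) split′)
    mergeable-before : mergeable L′ (g y) ≡ true → candidate L y ≡ true
    mergeable-before merge′ with mergeable⁻ L′ (g y) merge′
    ... | _ , single′ , _ , previous-below-y′ =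
      ∨≡trueʳ (splittable L y) (mergeable⁺ y∈L (<-trans 1<b b<y) single largest)
      where
      single : length (blockOf (blk y) L) ≡ 1
      single = trans (sym (length-blockOf-reblock (merge-shifts-later (blk y) b<y)))
                     (subst (λ j → length (blockOf j L′) ≡ 1) fy single′)
      c<y : ltᶜ c y ≡ true
      c<y = previous-below-y′ (∈-blockOf-reblock⁺ c∈L
              (trans mergeBlock-c (cong pred (sym (trans fy (cong pred y∈1+b))))))
      largest : ∀ {d} → d ∈ blockOf (blk y ∸ 1) L → ltᶜ d y ≡ true
      largest d∈ with ∈-blockOf⁻ L d∈
      ... | d∈L , d∈b with c-alone d∈L (trans d∈b (cong pred y∈1+b))
      ... | refl = c<y

  others-below : ∀ {y} → y ∈ L → lcell y ≢ lcell c → candidate L′ (g y) ≡ true → ltᶜ y c ≡ true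
  others-below y∈L y≢c cand′ with mergeView y∈L
  ... | self refl = ⊥-elim (y≢c refl)
  ... | earlier _ y≤b′ fy with m≤n⇒m<n∨m≡n y≤b′
  ... | inj₂ y∈b′ = previous-below-c y∈L y∈b′
  ... | inj₁ y<b′ = cellOf-greatest L cell≡c y∈L y≢c (trans (sym (candidate-reblock _ fy refl
        (merge-keeps-earlier y<b′) (merge-keeps-earlier (≤-<-trans (m∸n≤m _ 1) y<b′)) (mk⇔ id id))) cand′)
  others-below {y} y∈L y≢c cand′ | later _ b<y fy with m≤n⇒m<n∨m≡n b<y
  ... | inj₂ y∈1+b = cellOf-greatest L cell≡c y∈L y≢c (next-block-candidate y∈L (sym y∈1+b) cand′)
  ... | inj₁ 1+b<y = cellOf-greatest L cell≡c y∈L y≢c (trans (sym (candidate-reblock _ fy refl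
        (merge-shifts-later (blk y) b<y) (merge-shifts-later (pred (blk y)) b<y′)
        (mk⇔ (λ _ → <-trans 1<b b<y) (λ _ → <-trans 1<b b<y′)))) cand′)
    where
    b<y′ : b < pred (blk y)
    b<y′ = <⇒≤pred 1+b<y

  cellOf-merge : cellOf L′ ≡ just (g c)
  cellOf-merge = cellOf-reblock distinct c∈L (∨≡trueˡ _ c-splittable-after) others-below

  splitBlock-mergeBlock : ∀ {x} → x ∈ L → splitBlock (g c) (g x) ≡ blk x
  splitBlock-mergeBlock {x} x∈L with mergeView x∈L
  ... | self refl = trans (if-true (≡⇒sameCell≡true (lcell c) (lcell c) refl)) (trans (cong suc mergeBlock-c) 1+b′≡b)
  ... | later x≢c b<x fx = trans (if-false (≢⇒sameCell≡false _ _ x≢c))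
        (trans (if-true (<⇒<ᵇ≡true (subst₂ _<_ (sym mergeBlock-c) (sym fx) (<-≤-trans b′<b (<⇒≤pred b<x)))))
        (trans (cong suc fx) (suc-pred (blk x) {{>-nonZero (blk≥1 x∈L)}})))
  ... | earlier x≢c x≤b′ fx = trans (if-false (≢⇒sameCell≡false _ _ x≢c))
        (trans (if-false (≥⇒<ᵇ≡false (subst₂ _≤_ (sym fx) (sym mergeBlock-c) x≤b′))) fx)

rowCells-row : ∀ r a b {v} → v ∈ rowCells r a b → row v ≡ r
rowCells-row r a b v∈ with ∈-map⁻ (λ t → (r , a + t)) v∈
... | _ , _ , refl = refl

rowCells-outside : ∀ mu r b {v} → v ∈ rowCells r (part mu r) b → ¬ InDiagram mu v
rowCells-outside mu r b v∈ with ∈-map⁻ (λ t → (r , part mu r + t)) v∈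
... | t , _ , refl = m+n≮m (part mu r) t

rowCells-unique : ∀ r a b → Unique (rowCells r a b)
rowCells-unique r a b = Unique.map⁺ (λ same → +-cancelˡ-≡ a _ _ (cong proj₂ same)) (Unique.upTo⁺ (b ∸ a))

module _ (la mu : Partition) where

  private
    skewRow : ℕ → List Cell
    skewRow r = rowCells r (part mu r) (part la r)

  skewCells-outside : ∀ {v} → v ∈ skewCells la mu → ¬ InDiagram mu v
  skewCells-outside v∈ with ∈-concat⁻′ (map skewRow (upTo (length la))) v∈
  ... | _ , v∈row , row∈ with ∈-map⁻ skewRow row∈
  ... | r , _ , refl = rowCells-outside mu r (part la r) v∈row

  concatMap-skewRow-unique : ∀ rs → Unique rs → Unique (concatMap skewRow rs)
  concatMap-skewRow-unique [] [] = []
  concatMap-skewRow-unique (r ∷ rs) (r∉ ∷ unique) =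
    Unique.++⁺ (rowCells-unique r _ _) (concatMap-skewRow-unique rs unique) disjoint
    where
    disjoint : ∀ {v} → ¬ (v ∈ skewRow r × v ∈ concatMap skewRow rs)
    disjoint (v∈r , v∈rs) with ∈-concat⁻′ (map skewRow rs) v∈rs
    ... | _ , v∈row , row∈ with ∈-map⁻ skewRow row∈
    ... | r′ , r′∈rs , refl =
      All.lookup r∉ r′∈rs (trans (sym (rowCells-row r _ _ v∈r)) (rowCells-row r′ _ _ v∈row))

  skewCells-unique : Unique (skewCells la mu)
  skewCells-unique = concatMap-skewRow-unique (upTo (length la)) (Unique.upTo⁺ (length la))

map-lcell-zip : ∀ (cs : List Cell) (bs : List (ℕ × ℕ)) → length bs ≡ length cs → map lcell (zip cs bs) ≡ cs
map-lcell-zip [] [] _ = refl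
map-lcell-zip (c ∷ cs) (b ∷ bs) same-length = cong (c ∷_) (map-lcell-zip cs bs (suc-injective same-length))

map-label-zip : ∀ (cs : List Cell) (bs : List (ℕ × ℕ)) → length bs ≡ length cs →
                map (λ x → (blk x , ent x)) (zip cs bs) ≡ bs
map-label-zip [] [] _ = refl
map-label-zip (c ∷ cs) (b ∷ bs) same-length = cong (b ∷_) (map-label-zip cs bs (suc-injective same-length))

zip-relabel : ∀ (f : LCell → ℕ) (cs : List Cell) bs → zip cs (relabel f (zip cs bs)) ≡ map (reblock f) (zip cs bs)
zip-relabel f [] bs = refl
zip-relabel f (c ∷ cs) [] = refl
zip-relabel f (c ∷ cs) (b ∷ bs) = cong (_ ∷_) (zip-relabel f cs bs)

wt-relabel : ∀ f L n →
  length (filterᵇ (λ be → proj₂ be ≡ᵇ n) (relabel f L)) ≡ length (filterᵇ (λ x → ent x ≡ᵇ n) L)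
wt-relabel f L n = trans (cong length (filterᵇ-map _ _ L)) (length-map _ (filterᵇ (λ x → ent x ≡ᵇ n) L))

-- The involution

Φ-fixed : ∀ la mu T → cellOf (labelled la mu T) ≡ nothing → Φ la mu T ≡ T
Φ-fixed la mu T none rewrite none = refl

Φ-split : ∀ la mu T c → cellOf (labelled la mu T) ≡ just c → splittable (labelled la mu T) c ≡ true →
          Φ la mu T ≡ (suc (ℓ T) , relabel (splitBlock c) (labelled la mu T))
Φ-split la mu T c cell≡c split rewrite cell≡c | split = refl

Φ-merge : ∀ la mu T c → cellOf (labelled la mu T) ≡ just c → splittable (labelled la mu T) c ≡ false →
          Φ la mu T ≡ (ℓ T ∸ 1 , relabel (mergeBlock c) (labelled la mu T))
Φ-merge la mu T c cell≡c not-split rewrite cell≡c | not-split = refl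

sgn-suc : ∀ k → sgn (suc k) ≡ - sgn k
sgn-suc k = -1*i≡-i (sgn k)

sgn-pred : ∀ {k} → 1 ≤ k → sgn (pred k) ≡ - sgn k
sgn-pred {suc k} _ = sym (trans (cong -_ (sgn-suc k)) (neg-involutive (sgn k)))

SignReversingInvolutionAt : Partition → Partition → Elt → Set
SignReversingInvolutionAt la mu T =
    InX la mu (Φ la mu T)
  × Φ la mu (Φ la mu T) ≡ T
  × (∀ n → wt (Φ la mu T) n ≡ wt T n)
  × (Φ la mu T ≢ T → sgn (ℓ (Φ la mu T)) ≡ - sgn (ℓ T))

module Involution (la mu : Partition) (k : ℕ) (bs : List (ℕ × ℕ)) (inX : InX la mu (k , bs)) where

  private
    T = (k , bs)
    cells = skewCells la mu
    L = labelled la mu T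

  distinct : DistinctCells L
  distinct = subst Unique (sym (map-lcell-zip cells bs (proj₁ inX))) (skewCells-unique la mu)

  outside : ∀ {x} → x ∈ L → ¬ InDiagram mu (lcell x)
  outside x∈L = skewCells-outside la mu (subst (_ ∈_) (map-lcell-zip cells bs (proj₁ inX)) (∈-map⁺ lcell x∈L))

  valid : ValidFilling mu k L
  valid = proj₂ inX

  module Relabelled (f : LCell → ℕ) (k′ : ℕ) where

    private
      T′ = (k′ , relabel f L)

    labelled-relabel : labelled la mu T′ ≡ map (reblock f) L
    labelled-relabel = zip-relabel f cells bs

    relabel-inverse : ∀ f′ → (∀ {x} → x ∈ L → f′ (reblock f x) ≡ blk x) →
                      relabel f′ (labelled la mu T′) ≡ bs
    relabel-inverse f′ inverse = begin
      relabel f′ (labelled la mu T′)             ≡⟨ cong (relabel f′) labelled-relabel ⟩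
      relabel f′ (map (reblock f) L)             ≡⟨ sym (map-∘ L) ⟩
      map (λ x → (f′ (reblock f x) , ent x)) L
        ≡⟨ map-cong-local (All.tabulate (λ x∈L → cong (_, _) (inverse x∈L))) ⟩
      map (λ x → (blk x , ent x)) L              ≡⟨ map-label-zip cells bs (proj₁ inX) ⟩
      bs                                         ∎
      where open ≡-Reasoning

    InX-relabelled : ValidFilling mu k′ (map (reblock f) L) → InX la mu T′
    InX-relabelled valid′ = same-length , subst (ValidFilling mu k′) (sym labelled-relabel) valid′
      where
      open ≡-Reasoning
      same-length : length (relabel f L) ≡ length cells
      same-length = begin
        length (relabel f L) ≡⟨ length-map _ L ⟩
        length L             ≡⟨ sym (length-map lcell L) ⟩
        length (map lcell L) ≡⟨ cong length (map-lcell-zip cells bs (proj₁ inX)) ⟩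
        length cells         ∎

    wt-relabelled : ∀ n → wt T′ n ≡ wt T n
    wt-relabelled n = begin
      wt T′ n                                 ≡⟨ wt-relabel f L n ⟩
      length (filterᵇ (λ x → ent x ≡ᵇ n) L)   ≡⟨ sym (wt-relabel blk L n) ⟩
      wt (k , relabel blk L) n                ≡⟨ cong (λ B → wt (k , B) n) (map-label-zip cells bs (proj₁ inX)) ⟩
      wt T n                                  ∎
      where open ≡-Reasoning

    by-relabelling : Φ la mu T ≡ T′ → ValidFilling mu k′ (map (reblock f) L) → Φ la mu T′ ≡ T →
                     sgn k′ ≡ - sgn k → SignReversingInvolutionAt la mu T
    by-relabelling ΦT≡T′ valid′ ΦT′≡T sign =
        subst (InX la mu) (sym ΦT≡T′) (InX-relabelled valid′)
      , trans (cong (Φ la mu) ΦT≡T′) ΦT′≡T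
      , (λ n → trans (cong (λ U → wt U n) ΦT≡T′) (wt-relabelled n))
      , (λ _ → trans (cong (sgn ∘ ℓ) ΦT≡T′) sign)

  fixed-case : cellOf L ≡ nothing → SignReversingInvolutionAt la mu T
  fixed-case none = subst (InX la mu) (sym ΦT≡T) inX , trans (cong (Φ la mu) ΦT≡T) ΦT≡T
                  , (λ n → cong (λ U → wt U n) ΦT≡T) , (λ ΦT≢T → ⊥-elim (ΦT≢T ΦT≡T))
    where
    ΦT≡T : Φ la mu T ≡ T
    ΦT≡T = Φ-fixed la mu T none

  split-case : ∀ c → cellOf L ≡ just c → splittable L c ≡ true → SignReversingInvolutionAt la mu T
  split-case c cell≡c split =
    by-relabelling (Φ-split la mu T c cell≡c split) split-valid Φ-back (sgn-suc k)
    where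
    open Split mu k L distinct outside valid c cell≡c split
    open Relabelled (splitBlock c) (suc k)
    Φ-back : Φ la mu (suc k , relabel (splitBlock c) L) ≡ T
    Φ-back = trans
      (Φ-merge la mu _ (reblock (splitBlock c) c) (trans (cong cellOf labelled-relabel) cellOf-split)
               (trans (cong (λ M → splittable M _) labelled-relabel) c-not-splittable-after))
      (cong (k ,_) (relabel-inverse _ mergeBlock-splitBlock))

  merge-case : ∀ c → cellOf L ≡ just c → splittable L c ≡ false → SignReversingInvolutionAt la mu T
  merge-case c cell≡c not-split =
    by-relabelling (Φ-merge la mu T c cell≡c not-split) merge-valid Φ-back (sgn-pred k≥1)
    where
    open Merge mu k L distinct outside valid c cell≡c (cellOf-mergeable L cell≡c not-split)
    open Relabelled (mergeBlock c) (pred k)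
    Φ-back : Φ la mu (pred k , relabel (mergeBlock c) L) ≡ T
    Φ-back = trans
      (Φ-split la mu _ (reblock (mergeBlock c) c) (trans (cong cellOf labelled-relabel) cellOf-merge)
               (trans (cong (λ M → splittable M _) labelled-relabel) c-splittable-after))
      (cong₂ _,_ (suc-pred k {{>-nonZero k≥1}}) (relabel-inverse _ splitBlock-mergeBlock))

  involution : SignReversingInvolutionAt la mu T
  involution = by-cell (cellOf L) refl
    where
    by-kind : ∀ c → cellOf L ≡ just c → ∀ s → splittable L c ≡ s → SignReversingInvolutionAt la mu T
    by-kind c cell≡c true = split-case c cell≡c
    by-kind c cell≡c false = merge-case c cell≡c
    by-cell : ∀ r → cellOf L ≡ r → SignReversingInvolutionAt la mu T
    by-cell nothing = fixed-case
    by-cell (just c) cell≡c = by-kind c cell≡c (splittable L c) refl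

lemma2p3 : (mu la : Partition) → IsPartition mu → IsPartition la → mu ⊆ₚ la →
    (T : Elt) → InX la mu T →
      InX la mu (Φ la mu T)
    × Φ la mu (Φ la mu T) ≡ T
    × (∀ n → wt (Φ la mu T) n ≡ wt T n)
    × (Φ la mu T ≢ T → sgn (ℓ (Φ la mu T)) ≡ - sgn (ℓ T))
lemma2p3 mu la _ _ _ (k , bs) = Involution.involution la mu k bs
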